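{- Let $\Sigma$ be a finite totally ordered alphabet containing letters ${\tt a}<{\tt b}$, and let $v$ be the reverse of a Fibonacci word $s$, with $|v|\geq 2$. (1) If $s$ has even order $2k$ and ${\tt x}\in\Sigma$ is a letter with ${\tt x}>{\tt b}$, then $r(v{\tt x})=2k+1$. (2) If $s$ has odd order $2k+1$ and ${\tt x}\in\Sigma$ is a letter with ${\tt x}<{\tt a}$, then $2k+2\leq r(v{\tt x})\leq 2k+3$.
   Context: Words are indexed from $0$. For a word $w$ of length $n$, its conjugates (rotations) are $\mathrm{conj}_i(w)=w[i..n-1]w[0..i-1]$, $0\le i<n$. The Burrows–Wheeler Transform $\mathrm{BWT}(w)$ is obtained by sorting the $n$ conjugates of $w$ lexicographically (ties broken by index) and concatenating their last characters. $\mathrm{runs}(u)$ denotes the number of maximal equal-letter runs of a word $u$, and $r(w)=\mathrm{runs}(\mathrm{BWT}(w))$. Fibonacci words are defined by $s_0={\tt b}$, $s_1={\tt a}$, $s_{i+1}=s_is_{i-1}$ for $i\geq1$; $s_i$ is the Fibonacci word of order $i$. The reverse of $w=w[0]\cdots w[n-1]$ is $w[n-1]\cdots w[0]$. -}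

module Defs where

open import Data.Nat using (ℕ; zero; suc; _+_)
open import Data.Bool using (Bool; true; false; if_then_else_; _∧_; _∨_; not)
open import Data.Fin using (Fin; toℕ)
open import Data.List using (List; []; _∷_; _++_; drop; take; length; map; upTo; concatMap)
open import Data.Product using (_×_; _,_; proj₁; proj₂)
open import Relation.Nullary.Decidable using (⌊_⌋)
import Data.Nat as ℕ
import Data.Fin as F

-- Alphabet: Fin n (every finite totally ordered set is order-isomorphic to some Fin n),
-- ordered by the usual order on Fin n.

fib : ∀ {n} → Fin n → Fin n → ℕ → List (Fin n)
fib a b zero = b ∷ []
fib a b (suc zero) = a ∷ []
fib a b (suc (suc i)) = fib a b (suc i) ++ fib a b i

rev : ∀ {A : Set} → List A → List A
rev [] = []
rev (c ∷ w) = rev w ++ (c ∷ [])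

conj : ∀ {A : Set} → ℕ → List A → List A
conj i w = drop i w ++ take i w

_=?_ : ∀ {n} → Fin n → Fin n → Bool
c =? d = ⌊ c F.≟ d ⌋

_<?_ : ∀ {n} → Fin n → Fin n → Bool
c <? d = ⌊ c F.<? d ⌋

lexLt : ∀ {n} → List (Fin n) → List (Fin n) → Bool
lexLt [] [] = false
lexLt [] (_ ∷ _) = true
lexLt (_ ∷ _) [] = false
lexLt (c ∷ u) (d ∷ v) = (c <? d) ∨ ((c =? d) ∧ lexLt u v)

pairLeq : ∀ {n} → ℕ × List (Fin n) → ℕ × List (Fin n) → Bool
pairLeq (i , u) (j , v) =
  lexLt u v ∨ (not (lexLt v u) ∧ ⌊ i ℕ.≤? j ⌋)

insert : ∀ {n} → ℕ × List (Fin n) → List (ℕ × List (Fin n)) → List (ℕ × List (Fin n))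
insert p [] = p ∷ []
insert p (q ∷ qs) = if pairLeq p q then p ∷ q ∷ qs else q ∷ insert p qs

sort : ∀ {n} → List (ℕ × List (Fin n)) → List (ℕ × List (Fin n))
sort [] = []
sort (p ∷ ps) = insert p (sort ps)

lastL : ∀ {A : Set} → List A → List A
lastL [] = []
lastL (c ∷ []) = c ∷ []
lastL (c ∷ d ∷ w) = lastL (d ∷ w)

BWT : ∀ {n} → List (Fin n) → List (Fin n)
BWT w = concatMap (λ p → lastL (proj₂ p))
          (sort (map (λ i → (i , conj i w)) (upTo (length w))))

runs : ∀ {n} → List (Fin n) → ℕ
runs [] = 0
runs (c ∷ []) = 1
runs (c ∷ d ∷ w) = if c =? d then runs (d ∷ w) else suc (runs (d ∷ w))

r : ∀ {n} → List (Fin n) → ℕ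
r w = runs (BWT w)

module Submission where

open import Defs
open import Data.Bool using (Bool; true; false; T; _∧_; _∨_; not; if_then_else_)
open import Data.Empty using (⊥-elim)
open import Data.Fin using (Fin)
open import Data.Fin using () renaming (_<_ to _<ᶠ_)
import Data.Fin as Fin
import Data.Fin.Properties as Finₚ
open import Data.List
  using (List; _∷_; []; _++_; _∷ʳ_; length; map; concatMap; filterᵇ; replicate; drop; take; null; upTo; applyUpTo;
         initLast; _∷ʳ′_)
open import Data.List.Properties
  using (map-injective; ++-assoc; ++-identityʳ; length-++; ∷ʳ-++; map-++; map-∘; concatMap-map; drop-map; take-map;
         take++drop≡id; length-drop; length-map; map-applyUpTo)
open import Data.List.Relation.Binary.Permutation.Propositional as Perm
  using (_↭_; ↭-refl; ↭-prep; ↭-swap; ↭-trans; ↭-sym; ↭-reflexive; module PermutationReasoning)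
open import Data.List.Relation.Binary.Permutation.Propositional.Properties using (shift; shifts; ++-comm)
open import Data.List.Relation.Unary.All as All using (All; []; _∷_)
open import Data.List.Relation.Unary.All.Properties
  using (all-filter; filter⁺; ++⁺; ++⁻ʳ; ∷ʳ⁺; map⁺; drop⁺; applyUpTo⁺₁)
open import Data.List.Relation.Unary.AllPairs using (AllPairs; []; _∷_)
open import Data.Nat using (ℕ; zero; suc; _+_; _*_; _∸_; _≤_; _<_; z≤n; s≤s)
import Data.Nat as ℕ
open import Data.Nat.Properties using (m+n∸n≡m; +-comm; +-suc; ∸-cancelˡ-≡; +-monoʳ-≤)
import Data.Nat.Properties as ℕ
open import Data.Nat.Solver using (module +-*-Solver)
open +-*-Solver using (solve; _:=_; _:+_; _:*_; con)
open import Data.Product using (_×_; ∃-syntax; _,_; proj₁; proj₂)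
open import Data.Unit using (tt)
open import Function using (_∘_)
open import Function.Definitions using (Injective)
open import Relation.Binary.Definitions using (tri<; tri≈; tri>)
open import Relation.Binary.PropositionalEquality using (_≡_; _≢_; refl; sym; cong; cong₂; module ≡-Reasoning)
import Relation.Binary.PropositionalEquality as ≡
open import Relation.Nullary using (Dec; ¬_; yes; no)
open import Relation.Nullary.Decidable using (⌊_⌋; isYes≗does; dec-true; dec-false; T?)

-- Because x occurs only once, at the end of w = v x, two rotations of w are compared before
-- their copies of x; so sorting the rotations of w is sorting its suffixes, and BWT(w) lists
-- the letters cyclically preceding the sorted suffixes. The reversed Fibonacci words satisfy
-- v(m+1) = φ(v(m)) for the morphism φ : a ↦ ba, b ↦ a, which reverses the relative order of
-- a and b. The suffixes of φ(v x) are x, the words φ k for the suffixes k starting with a,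
-- and the words a φ k for the proper suffixes k; sorted, they form three blocks, ordered as
-- the letters a, b, x, each listing suffixes of v x in the order with a and b exchanged.
-- Recording for each suffix its preceding letter, its first letter and whether it starts at
-- position 0 or 1 turns this into an explicit map on such profile sequences. Four run-length
-- shapes, one for each parity and each position of x relative to a and b, are carried into
-- each other by this map, and counting the runs of their preceding letters gives 2k + 1,
-- respectively 2k + 2 or 2k + 3.

true≢false : true ≢ false
true≢false ()

isYes-true : ∀ {P : Set} (P? : Dec P) → P → ⌊ P? ⌋ ≡ true
isYes-true P? p = ≡.trans (isYes≗does P?) (dec-true P? p)

isYes-false : ∀ {P : Set} (P? : Dec P) → ¬ P → ⌊ P? ⌋ ≡ false
isYes-false P? ¬p = ≡.trans (isYes≗does P?) (dec-false P? ¬p)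

record IsStrictTotalᵇ {T : Set} (_<ᵇ_ : T → T → Bool) : Set where
  field
    irrefl : ∀ x → (x <ᵇ x) ≡ false
    asym   : ∀ x y → (x <ᵇ y) ≡ true → (y <ᵇ x) ≡ false
    trans  : ∀ x y z → (x <ᵇ y) ≡ true → (y <ᵇ z) ≡ true → (x <ᵇ z) ≡ true
    tri    : ∀ x y → (x <ᵇ y) ≡ false → (y <ᵇ x) ≡ false → x ≡ y

module _ {n : ℕ} where

  <?-irrefl : (c : Fin n) → (c <? c) ≡ false
  <?-irrefl c = isYes-false (c Fin.<? c) (Finₚ.<-irrefl refl)

  =?-refl : (c : Fin n) → (c =? c) ≡ true
  =?-refl c = isYes-true (c Fin.≟ c) refl

  lexLt-≡ : ∀ (c : Fin n) u v → lexLt (c ∷ u) (c ∷ v) ≡ lexLt u v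
  lexLt-≡ c u v = cong₂ (λ p q → p ∨ (q ∧ lexLt u v)) (<?-irrefl c) (=?-refl c)

  lexLt-< : ∀ {c d : Fin n} u v → c <ᶠ d → lexLt (c ∷ u) (d ∷ v) ≡ true
  lexLt-< {c} {d} u v c<d = cong (_∨ ((c =? d) ∧ lexLt u v)) (isYes-true (c Fin.<? d) c<d)

  lexLt-> : ∀ {c d : Fin n} u v → d <ᶠ c → lexLt (c ∷ u) (d ∷ v) ≡ false
  lexLt-> {c} {d} u v d<c =
    cong₂ (λ p q → p ∨ (q ∧ lexLt u v))
      (isYes-false (c Fin.<? d) (Finₚ.<-asym d<c))
      (isYes-false (c Fin.≟ d) (Finₚ.<⇒≢ d<c ∘ sym))

  lexLt-head : ∀ {c d : Fin n} → c ≢ d → ∀ u v u′ v′ → lexLt (c ∷ u) (d ∷ v) ≡ lexLt (c ∷ u′) (d ∷ v′)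
  lexLt-head {c} {d} c≢d u v u′ v′ with Finₚ.<-cmp c d
  ... | tri< c<d _ _ = ≡.trans (lexLt-< u v c<d) (sym (lexLt-< u′ v′ c<d))
  ... | tri≈ _ c≡d _ = ⊥-elim (c≢d c≡d)
  ... | tri> _ _ d<c = ≡.trans (lexLt-> u v d<c) (sym (lexLt-> u′ v′ d<c))

  lexLt-isStrictTotal : IsStrictTotalᵇ (lexLt {n})
  lexLt-isStrictTotal = record { irrefl = irrefl ; asym = asym ; trans = transitive ; tri = tri }
    where
    irrefl : ∀ u → lexLt u u ≡ false
    irrefl [] = refl
    irrefl (c ∷ u) = ≡.trans (lexLt-≡ c u u) (irrefl u)

    asym : ∀ u v → lexLt u v ≡ true → lexLt v u ≡ false
    asym [] (d ∷ v) _ = refl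
    asym (c ∷ u) (d ∷ v) u<v with Finₚ.<-cmp c d
    ... | tri< c<d _ _ = lexLt-> v u c<d
    ... | tri≈ _ refl _ = ≡.trans (lexLt-≡ c v u) (asym u v (≡.trans (sym (lexLt-≡ c u v)) u<v))
    ... | tri> _ _ d<c = ⊥-elim (true≢false (≡.trans (sym u<v) (lexLt-> u v d<c)))

    transitive : ∀ u v w → lexLt u v ≡ true → lexLt v w ≡ true → lexLt u w ≡ true
    transitive [] (_ ∷ _) (_ ∷ _) _ _ = refl
    transitive (c ∷ u) (d ∷ v) (e ∷ w) u<v v<w with Finₚ.<-cmp c d | Finₚ.<-cmp d e
    ... | tri> _ _ d<c | _ = ⊥-elim (true≢false (≡.trans (sym u<v) (lexLt-> u v d<c)))
    ... | _ | tri> _ _ e<d = ⊥-elim (true≢false (≡.trans (sym v<w) (lexLt-> v w e<d)))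
    ... | tri< c<d _ _ | tri< d<e _ _ = lexLt-< u w (Finₚ.<-trans c<d d<e)
    ... | tri< c<d _ _ | tri≈ _ refl _ = lexLt-< u w c<d
    ... | tri≈ _ refl _ | tri< d<e _ _ = lexLt-< u w d<e
    ... | tri≈ _ refl _ | tri≈ _ refl _ =
      ≡.trans (lexLt-≡ c u w) (transitive u v w (≡.trans (sym (lexLt-≡ c u v)) u<v) (≡.trans (sym (lexLt-≡ c v w)) v<w))

    tri : ∀ u v → lexLt u v ≡ false → lexLt v u ≡ false → u ≡ v
    tri [] [] _ _ = refl
    tri (c ∷ u) (d ∷ v) u≮v v≮u with Finₚ.<-cmp c d
    ... | tri< c<d _ _ = ⊥-elim (true≢false (≡.trans (sym (lexLt-< u v c<d)) u≮v))
    ... | tri≈ _ refl _ = cong (c ∷_) (tri u v (≡.trans (sym (lexLt-≡ c u v)) u≮v) (≡.trans (sym (lexLt-≡ c v u)) v≮u))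
    ... | tri> _ _ d<c = ⊥-elim (true≢false (≡.trans (sym (lexLt-< v u d<c)) v≮u))

  lexLt-sentinel : ∀ {x : Fin n} u v s t → All (_≢ x) u → All (_≢ x) v → u ≢ v →
                   lexLt (u ++ x ∷ s) (v ++ x ∷ t) ≡ lexLt (u ++ x ∷ []) (v ++ x ∷ [])
  lexLt-sentinel [] [] s t _ _ u≢v = ⊥-elim (u≢v refl)
  lexLt-sentinel {x} [] (d ∷ v) s t _ (d≢x ∷ _) _ = lexLt-head (d≢x ∘ sym) s (v ++ x ∷ t) [] (v ++ x ∷ [])
  lexLt-sentinel {x} (c ∷ u) [] s t (c≢x ∷ _) _ _ = lexLt-head c≢x (u ++ x ∷ s) t (u ++ x ∷ []) []
  lexLt-sentinel {x} (c ∷ u) (d ∷ v) s t (_ ∷ u≢x) (_ ∷ v≢x) cu≢dv with Finₚ.<-cmp c d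
  ... | tri< c<d _ _ = lexLt-head (Finₚ.<⇒≢ c<d) (u ++ x ∷ s) (v ++ x ∷ t) (u ++ x ∷ []) (v ++ x ∷ [])
  ... | tri> _ _ d<c = lexLt-head (Finₚ.<⇒≢ d<c ∘ sym) (u ++ x ∷ s) (v ++ x ∷ t) (u ++ x ∷ []) (v ++ x ∷ [])
  ... | tri≈ _ refl _ = begin
    lexLt (c ∷ u ++ x ∷ s) (c ∷ v ++ x ∷ t)   ≡⟨ lexLt-≡ c (u ++ x ∷ s) (v ++ x ∷ t) ⟩
    lexLt (u ++ x ∷ s) (v ++ x ∷ t)           ≡⟨ lexLt-sentinel u v s t u≢x v≢x (cu≢dv ∘ cong (c ∷_)) ⟩
    lexLt (u ++ x ∷ []) (v ++ x ∷ [])         ≡⟨ lexLt-≡ c (u ++ x ∷ []) (v ++ x ∷ []) ⟨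
    lexLt (c ∷ u ++ x ∷ []) (c ∷ v ++ x ∷ []) ∎
    where open ≡-Reasoning

insertBy : ∀ {T : Set} → (T → T → Bool) → T → List T → List T
insertBy _≤ᵇ_ x [] = x ∷ []
insertBy _≤ᵇ_ x (y ∷ ys) = if x ≤ᵇ y then x ∷ y ∷ ys else y ∷ insertBy _≤ᵇ_ x ys

sortBy : ∀ {T : Set} → (T → T → Bool) → List T → List T
sortBy _≤ᵇ_ [] = []
sortBy _≤ᵇ_ (x ∷ xs) = insertBy _≤ᵇ_ x (sortBy _≤ᵇ_ xs)

sort≡sortBy : ∀ {n} (ps : List (ℕ × List (Fin n))) → sort ps ≡ sortBy pairLeq ps
sort≡sortBy [] = refl
sort≡sortBy (p ∷ ps) = ≡.trans (cong (insert p) (sort≡sortBy ps)) (insert≡insertBy (sortBy pairLeq ps))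
  where
  insert≡insertBy : ∀ qs → insert p qs ≡ insertBy pairLeq p qs
  insert≡insertBy [] = refl
  insert≡insertBy (q ∷ qs) with pairLeq p q
  ... | true = refl
  ... | false = cong (q ∷_) (insert≡insertBy qs)

module _ {T : Set} (_≤ᵇ_ : T → T → Bool) where

  insertBy-All : ∀ {P : T → Set} {x ys} → P x → All P ys → All P (insertBy _≤ᵇ_ x ys)
  insertBy-All px [] = px ∷ []
  insertBy-All {x = x} {y ∷ ys} px (py ∷ pys) with x ≤ᵇ y
  ... | true = px ∷ py ∷ pys
  ... | false = py ∷ insertBy-All px pys

  sortBy-All : ∀ {P : T → Set} {xs} → All P xs → All P (sortBy _≤ᵇ_ xs)
  sortBy-All [] = []
  sortBy-All (px ∷ pxs) = insertBy-All px (sortBy-All pxs)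

  concatMap-insertBy : ∀ {U : Set} (g : T → List U) x ys → g x ≡ [] →
                       concatMap g (insertBy _≤ᵇ_ x ys) ≡ concatMap g ys
  concatMap-insertBy g x [] gx = cong (_++ []) gx
  concatMap-insertBy g x (y ∷ ys) gx with x ≤ᵇ y
  ... | true = cong (_++ concatMap g (y ∷ ys)) gx
  ... | false = cong (g y ++_) (concatMap-insertBy g x ys gx)

module _ {T U : Set} {_≤₁_ : T → T → Bool} {_≤₂_ : U → U → Bool} (f : T → U) {P : T → Set}
         (f-monotone : ∀ {x y} → P x → P y → (f x ≤₂ f y) ≡ (x ≤₁ y)) where

  sortBy-map : ∀ {xs} → All P xs → sortBy _≤₂_ (map f xs) ≡ map f (sortBy _≤₁_ xs)
  sortBy-map [] = refl
  sortBy-map {x ∷ xs} (px ∷ pxs) =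
    ≡.trans (cong (insertBy _≤₂_ (f x)) (sortBy-map pxs)) (insertBy-map (sortBy-All _≤₁_ pxs))
    where
    insertBy-map : ∀ {ys} → All P ys → insertBy _≤₂_ (f x) (map f ys) ≡ map f (insertBy _≤₁_ x ys)
    insertBy-map [] = refl
    insertBy-map {y ∷ ys} (py ∷ pys) rewrite f-monotone px py with x ≤₁ y
    ... | true = refl
    ... | false = cong (f y ∷_) (insertBy-map pys)

module _ {T : Set} (p : T → Bool) where

  filterᵇ-accept : ∀ {x} xs → p x ≡ true → filterᵇ p (x ∷ xs) ≡ x ∷ filterᵇ p xs
  filterᵇ-accept xs px rewrite px = refl

  filterᵇ-reject : ∀ {x} xs → p x ≡ false → filterᵇ p (x ∷ xs) ≡ filterᵇ p xs
  filterᵇ-reject xs px rewrite px = refl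

module StrictTotalSort {T : Set} {_<ᵇ_ : T → T → Bool} (strict : IsStrictTotalᵇ _<ᵇ_) where
  open IsStrictTotalᵇ strict

  _≤ᵇ_ : T → T → Bool
  x ≤ᵇ y = not (y <ᵇ x)

  Sorted : List T → Set
  Sorted = AllPairs (λ x y → (x ≤ᵇ y) ≡ true)

  <⇒≤ : ∀ {x y} → (x <ᵇ y) ≡ true → (x ≤ᵇ y) ≡ true
  <⇒≤ {x} {y} x<y = cong not (asym x y x<y)

  ≤⇒≯ : ∀ {x y} → (x ≤ᵇ y) ≡ true → (y <ᵇ x) ≡ false
  ≤⇒≯ {x} {y} x≤y with y <ᵇ x
  ... | false = refl

  ≤-trans : ∀ {x y z} → (x ≤ᵇ y) ≡ true → (y ≤ᵇ z) ≡ true → (x ≤ᵇ z) ≡ true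
  ≤-trans {x} {y} {z} x≤y y≤z with z <ᵇ x in z<x
  ... | false = refl
  ... | true = ⊥-elim (true≢false (≡.trans (sym z<y) (≤⇒≯ y≤z)))
    where
    z<y : (z <ᵇ y) ≡ true
    z<y with x <ᵇ y in x<y
    ... | true = trans z x y z<x x<y
    ... | false with tri x y x<y (≤⇒≯ x≤y)
    ...   | refl = z<x

  insert-≤ : ∀ {x y} ys → (y <ᵇ x) ≡ false → insertBy _≤ᵇ_ x (y ∷ ys) ≡ x ∷ y ∷ ys
  insert-≤ ys y≮x rewrite y≮x = refl

  insert-> : ∀ {x y} ys → (y <ᵇ x) ≡ true → insertBy _≤ᵇ_ x (y ∷ ys) ≡ y ∷ insertBy _≤ᵇ_ x ys
  insert-> ys y<x rewrite y<x = refl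

  insert-comm-< : ∀ {x y} → (x <ᵇ y) ≡ true → ∀ zs →
                  insertBy _≤ᵇ_ x (insertBy _≤ᵇ_ y zs) ≡ insertBy _≤ᵇ_ y (insertBy _≤ᵇ_ x zs)
  insert-comm-< {x} {y} x<y [] = ≡.trans (insert-≤ [] (asym x y x<y)) (sym (insert-> [] x<y))
  insert-comm-< {x} {y} x<y (z ∷ zs) with z <ᵇ y in z<y | z <ᵇ x in z<x
  ... | false | true = ⊥-elim (true≢false (≡.trans (sym (trans z x y z<x x<y)) z<y))
  ... | false | false = ≡.trans (insert-≤ (z ∷ zs) (asym x y x<y))
                          (sym (≡.trans (insert-> (z ∷ zs) x<y) (cong (x ∷_) (insert-≤ zs z<y))))
  ... | true | false = ≡.trans (insert-≤ (insertBy _≤ᵇ_ y zs) z<x)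
                         (sym (≡.trans (insert-> (z ∷ zs) x<y) (cong (x ∷_) (insert-> zs z<y))))
  ... | true | true = ≡.trans (insert-> (insertBy _≤ᵇ_ y zs) z<x)
                        (sym (≡.trans (insert-> (insertBy _≤ᵇ_ x zs) z<y) (cong (z ∷_) (sym (insert-comm-< x<y zs)))))

  insert-comm : ∀ x y zs → insertBy _≤ᵇ_ x (insertBy _≤ᵇ_ y zs) ≡ insertBy _≤ᵇ_ y (insertBy _≤ᵇ_ x zs)
  insert-comm x y zs with x <ᵇ y in x<y | y <ᵇ x in y<x
  ... | true | _ = insert-comm-< x<y zs
  ... | false | true = sym (insert-comm-< y<x zs)
  ... | false | false with tri x y x<y y<x
  ... | refl = refl

  sort-↭ : ∀ {xs ys} → xs ↭ ys → sortBy _≤ᵇ_ xs ≡ sortBy _≤ᵇ_ ys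
  sort-↭ Perm.refl = refl
  sort-↭ (Perm.prep x p) = cong (insertBy _≤ᵇ_ x) (sort-↭ p)
  sort-↭ (Perm.swap {_} {ys} x y p) =
    ≡.trans (cong (insertBy _≤ᵇ_ x ∘ insertBy _≤ᵇ_ y) (sort-↭ p)) (insert-comm x y (sortBy _≤ᵇ_ ys))
  sort-↭ (Perm.trans p q) = ≡.trans (sort-↭ p) (sort-↭ q)

  insert-++ : ∀ x zs us → All (λ u → (x <ᵇ u) ≡ true) us →
              insertBy _≤ᵇ_ x (zs ++ us) ≡ insertBy _≤ᵇ_ x zs ++ us
  insert-++ x [] [] _ = refl
  insert-++ x [] (u ∷ us) (x<u ∷ _) = insert-≤ us (asym x u x<u)
  insert-++ x (z ∷ zs) us x<us with z <ᵇ x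
  ... | true = cong (z ∷_) (insert-++ x zs us x<us)
  ... | false = refl

  sort-++ : ∀ xs ys → All (λ x → All (λ y → (x <ᵇ y) ≡ true) ys) xs →
            sortBy _≤ᵇ_ (xs ++ ys) ≡ sortBy _≤ᵇ_ xs ++ sortBy _≤ᵇ_ ys
  sort-++ [] ys _ = refl
  sort-++ (x ∷ xs) ys (x<ys ∷ xs<ys) =
    ≡.trans (cong (insertBy _≤ᵇ_ x) (sort-++ xs ys xs<ys))
            (insert-++ x (sortBy _≤ᵇ_ xs) (sortBy _≤ᵇ_ ys) (sortBy-All _≤ᵇ_ x<ys))

  insert-sorted : ∀ x {ys} → Sorted ys → Sorted (insertBy _≤ᵇ_ x ys)
  insert-sorted x [] = [] ∷ []
  insert-sorted x {y ∷ ys} (y≤ys ∷ ys-sorted) with y <ᵇ x in y<x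
  ... | false = (x≤y ∷ All.map (≤-trans x≤y) y≤ys) ∷ y≤ys ∷ ys-sorted
    where x≤y = cong not y<x
  ... | true = insertBy-All _≤ᵇ_ (<⇒≤ y<x) y≤ys ∷ insert-sorted x ys-sorted

  sort-sorted : ∀ xs → Sorted (sortBy _≤ᵇ_ xs)
  sort-sorted [] = []
  sort-sorted (x ∷ xs) = insert-sorted x (sort-sorted xs)

  insert-head : ∀ {x zs} → All (λ z → (x ≤ᵇ z) ≡ true) zs → insertBy _≤ᵇ_ x zs ≡ x ∷ zs
  insert-head [] = refl
  insert-head {zs = z ∷ zs} (x≤z ∷ _) = insert-≤ zs (≤⇒≯ x≤z)

  module _ (p : T → Bool) where

    filter-insert-reject : ∀ {x} ys → p x ≡ false → filterᵇ p (insertBy _≤ᵇ_ x ys) ≡ filterᵇ p ys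
    filter-insert-reject [] px = filterᵇ-reject p [] px
    filter-insert-reject {x} (y ∷ ys) px with y <ᵇ x
    ... | false = filterᵇ-reject p (y ∷ ys) px
    ... | true with p y
    ...   | true = cong (y ∷_) (filter-insert-reject ys px)
    ...   | false = filter-insert-reject ys px

    filter-insert-accept : ∀ {x ys} → Sorted ys → p x ≡ true →
                           filterᵇ p (insertBy _≤ᵇ_ x ys) ≡ insertBy _≤ᵇ_ x (filterᵇ p ys)
    filter-insert-accept [] px = filterᵇ-accept p [] px
    filter-insert-accept {x} {y ∷ ys} (y≤ys ∷ ys-sorted) px with y <ᵇ x in y<x
    ... | false = ≡.trans (filterᵇ-accept p (y ∷ ys) px)
                    (sym (insert-head (filter⁺ (T? ∘ p) (x≤y ∷ All.map (≤-trans x≤y) y≤ys))))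
      where x≤y = cong not y<x
    ... | true with p y
    ...   | true = ≡.trans (cong (y ∷_) (filter-insert-accept ys-sorted px)) (sym (insert-> _ y<x))
    ...   | false = filter-insert-accept ys-sorted px

    sort-filter : ∀ xs → sortBy _≤ᵇ_ (filterᵇ p xs) ≡ filterᵇ p (sortBy _≤ᵇ_ xs)
    sort-filter [] = refl
    sort-filter (x ∷ xs) with p x in px
    ... | true = ≡.trans (cong (insertBy _≤ᵇ_ x) (sort-filter xs))
                   (sym (filter-insert-accept (sort-sorted xs) px))
    ... | false = ≡.trans (sort-filter xs) (sym (filter-insert-reject (sortBy _≤ᵇ_ xs) px))

-- Three letters and the morphism φ

data Letter : Set where
  A B X : Letter

data IsAB : Letter → Set where
  isA : IsAB A
  isB : IsAB B

module _ {n : ℕ} where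

  -- The order on letters is a parameter: embed a b x realises A, B, X as a, b, x, and
  -- exchanging the roles of a and b is a change of embedding.
  embed : Fin n → Fin n → Fin n → Letter → Fin n
  embed a b x A = a
  embed a b x B = b
  embed a b x X = x

  record Distinct (a b x : Fin n) : Set where
    field
      a≢b : a ≢ b
      a≢x : a ≢ x
      b≢x : b ≢ x

  swapDistinct : ∀ {a b x} → Distinct a b x → Distinct b a x
  swapDistinct d = record { a≢b = a≢b ∘ sym ; a≢x = b≢x ; b≢x = a≢x }
    where open Distinct d

  embed-injective : ∀ {a b x} → Distinct a b x → Injective _≡_ _≡_ (embed a b x)
  embed-injective d {A} {A} _ = refl
  embed-injective d {B} {B} _ = refl
  embed-injective d {X} {X} _ = refl
  embed-injective d {A} {B} e = ⊥-elim (Distinct.a≢b d e)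
  embed-injective d {A} {X} e = ⊥-elim (Distinct.a≢x d e)
  embed-injective d {B} {A} e = ⊥-elim (Distinct.a≢b d (sym e))
  embed-injective d {B} {X} e = ⊥-elim (Distinct.b≢x d e)
  embed-injective d {X} {A} e = ⊥-elim (Distinct.a≢x d (sym e))
  embed-injective d {X} {B} e = ⊥-elim (Distinct.b≢x d (sym e))

  lexOn : (Letter → Fin n) → List Letter → List Letter → Bool
  lexOn e u v = lexLt (map e u) (map e v)

  lexOn-isStrictTotal : ∀ {e} → Injective _≡_ _≡_ e → IsStrictTotalᵇ (lexOn e)
  lexOn-isStrictTotal {e} e-inj = record
    { irrefl = λ u → irrefl (map e u)
    ; asym = λ u v → asym (map e u) (map e v)
    ; trans = λ u v w → trans (map e u) (map e v) (map e w)
    ; tri = λ u v u≮v v≮u → map-injective e-inj (tri (map e u) (map e v) u≮v v≮u)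
    }
    where open IsStrictTotalᵇ lexLt-isStrictTotal

  sortOn : (Letter → Fin n) → List (List Letter) → List (List Letter)
  sortOn e = sortBy (λ u v → not (lexOn e v u))

-- Reversal conjugates the Fibonacci morphism a ↦ ab, b ↦ a into φ (see revFib).
φ : List Letter → List Letter
φ [] = []
φ (A ∷ u) = B ∷ A ∷ φ u
φ (B ∷ u) = A ∷ φ u
φ (X ∷ u) = X ∷ φ u

φ-++ : ∀ u v → φ (u ++ v) ≡ φ u ++ φ v
φ-++ [] v = refl
φ-++ (A ∷ u) v = cong (λ w → B ∷ A ∷ w) (φ-++ u v)
φ-++ (B ∷ u) v = cong (A ∷_) (φ-++ u v)
φ-++ (X ∷ u) v = cong (X ∷_) (φ-++ u v)

module _ {n : ℕ} {a b x : Fin n} (d : Distinct a b x) where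
  open Distinct d

  private
    e e′ : List Letter → List (Fin n)
    e = map (embed a b x)
    e′ = map (embed b a x)

  φ-lexOn : ∀ u v → lexOn (embed a b x) (φ u) (φ v) ≡ lexOn (embed b a x) u v
  φ-lexOn [] [] = refl
  φ-lexOn [] (A ∷ v) = refl
  φ-lexOn [] (B ∷ v) = refl
  φ-lexOn [] (X ∷ v) = refl
  φ-lexOn (A ∷ u) [] = refl
  φ-lexOn (B ∷ u) [] = refl
  φ-lexOn (X ∷ u) [] = refl
  φ-lexOn (A ∷ u) (A ∷ v) = begin
    lexLt (b ∷ a ∷ e (φ u)) (b ∷ a ∷ e (φ v)) ≡⟨ lexLt-≡ b (a ∷ e (φ u)) (a ∷ e (φ v)) ⟩
    lexLt (a ∷ e (φ u)) (a ∷ e (φ v))         ≡⟨ lexLt-≡ a (e (φ u)) (e (φ v)) ⟩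
    lexLt (e (φ u)) (e (φ v))                 ≡⟨ φ-lexOn u v ⟩
    lexLt (e′ u) (e′ v)                       ≡⟨ lexLt-≡ b (e′ u) (e′ v) ⟨
    lexLt (b ∷ e′ u) (b ∷ e′ v)               ∎
    where open ≡-Reasoning
  φ-lexOn (B ∷ u) (B ∷ v) = begin
    lexLt (a ∷ e (φ u)) (a ∷ e (φ v)) ≡⟨ lexLt-≡ a (e (φ u)) (e (φ v)) ⟩
    lexLt (e (φ u)) (e (φ v))         ≡⟨ φ-lexOn u v ⟩
    lexLt (e′ u) (e′ v)               ≡⟨ lexLt-≡ a (e′ u) (e′ v) ⟨
    lexLt (a ∷ e′ u) (a ∷ e′ v)       ∎
    where open ≡-Reasoning
  φ-lexOn (X ∷ u) (X ∷ v) = begin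
    lexLt (x ∷ e (φ u)) (x ∷ e (φ v)) ≡⟨ lexLt-≡ x (e (φ u)) (e (φ v)) ⟩
    lexLt (e (φ u)) (e (φ v))         ≡⟨ φ-lexOn u v ⟩
    lexLt (e′ u) (e′ v)               ≡⟨ lexLt-≡ x (e′ u) (e′ v) ⟨
    lexLt (x ∷ e′ u) (x ∷ e′ v)       ∎
    where open ≡-Reasoning
  φ-lexOn (A ∷ u) (B ∷ v) = lexLt-head (a≢b ∘ sym) (a ∷ e (φ u)) (e (φ v)) (e′ u) (e′ v)
  φ-lexOn (A ∷ u) (X ∷ v) = lexLt-head b≢x (a ∷ e (φ u)) (e (φ v)) (e′ u) (e′ v)
  φ-lexOn (B ∷ u) (A ∷ v) = lexLt-head a≢b (e (φ u)) (a ∷ e (φ v)) (e′ u) (e′ v)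
  φ-lexOn (B ∷ u) (X ∷ v) = lexLt-head a≢x (e (φ u)) (e (φ v)) (e′ u) (e′ v)
  φ-lexOn (X ∷ u) (A ∷ v) = lexLt-head (b≢x ∘ sym) (e (φ u)) (a ∷ e (φ v)) (e′ u) (e′ v)
  φ-lexOn (X ∷ u) (B ∷ v) = lexLt-head (a≢x ∘ sym) (e (φ u)) (e (φ v)) (e′ u) (e′ v)

-- Profiles of suffixes

suffixes : ∀ {T : Set} → List T → List (List T)
suffixes [] = []
suffixes (c ∷ w) = (c ∷ w) ∷ suffixes w

suffixes-∷ʳ : ∀ {T : Set} (v : List T) x → suffixes (v ∷ʳ x) ≡ (v ∷ʳ x) ∷ suffixes (drop 1 (v ∷ʳ x))
suffixes-∷ʳ [] x = refl
suffixes-∷ʳ (c ∷ v) x = refl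

lastOr : ∀ {T : Set} → T → List T → T
lastOr c [] = c
lastOr c (d ∷ u) = lastOr d u

headOr : ∀ {T : Set} → T → List T → T
headOr c [] = c
headOr c (d ∷ _) = d

isSingleton : ∀ {T : Set} → List T → Bool
isSingleton (_ ∷ []) = true
isSingleton _ = false

lastOr-∷ʳ : ∀ {T : Set} (c : T) u d → lastOr c (u ∷ʳ d) ≡ d
lastOr-∷ʳ c [] d = refl
lastOr-∷ʳ c (e ∷ u) d = lastOr-∷ʳ e u d

null-∷ʳ : ∀ {T : Set} (u : List T) d → null (u ∷ʳ d) ≡ false
null-∷ʳ [] d = refl
null-∷ʳ (_ ∷ _) d = refl

isSingleton-∷ʳ : ∀ {T : Set} (u : List T) d → isSingleton (u ∷ʳ d) ≡ null u
isSingleton-∷ʳ [] d = refl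
isSingleton-∷ʳ (_ ∷ []) d = refl
isSingleton-∷ʳ (_ ∷ _ ∷ _) d = refl

take-length-++ : ∀ {T : Set} (u k : List T) → take (length u) (u ++ k) ≡ u
take-length-++ [] k = refl
take-length-++ (c ∷ u) k = cong (c ∷_) (take-length-++ u k)

-- The profile of the suffix k of a word u ++ k that ends with the sentinel X: the letter
-- cyclically preceding k (X itself when u is empty), the first letter of k, and whether u
-- has length 0 or 1. This is all that the BWT and the passage to φ need.
record Profile : Set where
  constructor profile
  field
    prev : Letter
    lead : Letter
    at₀ : Bool
    at₁ : Bool

profileOf : List Letter → List Letter → Profile
profileOf u k = profile (lastOr X u) (headOr X k) (null u) (isSingleton u)

profileIn : List Letter → List Letter → Profile
profileIn w k = profileOf (take (length w ∸ length k) w) k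

profileIn-++ : ∀ u k → profileIn (u ++ k) k ≡ profileOf u k
profileIn-++ u k = cong (λ p → profileOf p k) (begin
  take (length (u ++ k) ∸ length k) (u ++ k) ≡⟨ cong (λ i → take (i ∸ length k) (u ++ k)) (length-++ u) ⟩
  take (length u + length k ∸ length k) (u ++ k) ≡⟨ cong (λ i → take i (u ++ k)) (m+n∸n≡m (length u) (length k)) ⟩
  take (length u) (u ++ k)                       ≡⟨ take-length-++ u k ⟩
  u                                              ∎)
  where open ≡-Reasoning

profileOf-∷ʳ : ∀ u c k → profileOf (u ∷ʳ c) k ≡ profile c (headOr X k) false (null u)
profileOf-∷ʳ u c k rewrite lastOr-∷ʳ X u c | null-∷ʳ u c | isSingleton-∷ʳ u c = refl

concatMap-singletons : ∀ {T U : Set} {g : T → List U} {h : T → U} {xs} →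
                       All (λ x → g x ≡ h x ∷ []) xs → concatMap g xs ≡ map h xs
concatMap-singletons [] = refl
concatMap-singletons (gx ∷ gxs) = cong₂ _++_ gx (concatMap-singletons gxs)

module _ {n : ℕ} where

  profiles : (Letter → Fin n) → List Letter → List Profile
  profiles e v = map (profileIn (v ∷ʳ X)) (sortOn e (suffixes (v ∷ʳ X)))

-- The Burrows–Wheeler transform of v X

drop-∷ʳ : ∀ {T : Set} i (v : List T) y → i ≤ length v → drop i (v ∷ʳ y) ≡ drop i v ∷ʳ y
drop-∷ʳ zero v y _ = refl
drop-∷ʳ (suc i) (c ∷ v) y (s≤s i≤v) = drop-∷ʳ i v y i≤v

<-length-∷ʳ : ∀ {T : Set} {i} (v : List T) y → i < length (v ∷ʳ y) → i ≤ length v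
<-length-∷ʳ {i = zero} v y _ = z≤n
<-length-∷ʳ {i = suc i} [] y (s≤s ())
<-length-∷ʳ {i = suc i} (c ∷ v) y (s≤s i<v) = s≤s (<-length-∷ʳ v y i<v)

lastL-++-∷ : ∀ {T : Set} (u : List T) y t → lastL (u ++ y ∷ t) ≡ lastOr y t ∷ []
lastL-++-∷ [] y [] = refl
lastL-++-∷ [] y (z ∷ t) = lastL-++-∷ [] z t
lastL-++-∷ (c ∷ []) y t = lastL-++-∷ [] y t
lastL-++-∷ (c ∷ d ∷ u) y t = lastL-++-∷ (d ∷ u) y t

lastOr-map : ∀ {T U : Set} (f : T → U) c t → lastOr (f c) (map f t) ≡ f (lastOr c t)
lastOr-map f c [] = refl
lastOr-map f c (d ∷ t) = lastOr-map f d t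

drop-injective : ∀ {T : Set} {i j} (u : List T) → i ≤ length u → j ≤ length u → drop i u ≡ drop j u → i ≡ j
drop-injective {i = i} {j} u i≤u j≤u eq =
  ∸-cancelˡ-≡ i≤u j≤u (≡.trans (sym (length-drop i u)) (≡.trans (cong length eq) (length-drop j u)))

applyUpTo-drop : ∀ {T : Set} (w : List T) → applyUpTo (λ i → drop i w) (length w) ≡ suffixes w
applyUpTo-drop [] = refl
applyUpTo-drop (c ∷ w) = cong ((c ∷ w) ∷_) (applyUpTo-drop w)

module _ {n : ℕ} {a b x : Fin n} (d : Distinct a b x) {v : List Letter} (v-AB : All IsAB v) where
  open Distinct d
  private
    e : Letter → Fin n
    e = embed a b x
    w = v ∷ʳ X
    wF = map e w
    module L = IsStrictTotalᵇ (lexOn-isStrictTotal (embed-injective d))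

  Rotation : ℕ × List (Fin n) → Set
  Rotation (i , c) = i < length w × c ≡ conj i wF

  suffixAt : ℕ × List (Fin n) → List Letter
  suffixAt (i , _) = drop i w

  conj-sentinel : ∀ i → i < length w → conj i wF ≡ map e (drop i v) ++ x ∷ map e (take i w)
  conj-sentinel i i<w = begin
    drop i wF ++ take i wF
      ≡⟨ cong₂ _++_ (drop-map i w) (take-map i w) ⟩
    map e (drop i w) ++ map e (take i w)
      ≡⟨ cong (λ s → map e s ++ map e (take i w)) (drop-∷ʳ i v X (<-length-∷ʳ v X i<w)) ⟩
    map e (drop i v ∷ʳ X) ++ map e (take i w)
      ≡⟨ cong (_++ map e (take i w)) (map-++ e (drop i v) (X ∷ [])) ⟩
    (map e (drop i v) ∷ʳ x) ++ map e (take i w)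
      ≡⟨ ∷ʳ-++ (map e (drop i v)) x (map e (take i w)) ⟩
    map e (drop i v) ++ x ∷ map e (take i w) ∎
    where open ≡-Reasoning

  lastL-conj : ∀ {p} → Rotation p → lastL (proj₂ p) ≡ e (Profile.prev (profileIn w (suffixAt p))) ∷ []
  lastL-conj {i , _} (i<w , refl) = begin
    lastL (conj i wF)                                     ≡⟨ cong lastL (conj-sentinel i i<w) ⟩
    lastL (map e (drop i v) ++ x ∷ map e (take i w))      ≡⟨ lastL-++-∷ (map e (drop i v)) x (map e (take i w)) ⟩
    lastOr x (map e (take i w)) ∷ []                      ≡⟨ cong (_∷ []) (lastOr-map e X (take i w)) ⟩
    e (lastOr X (take i w)) ∷ []                          ≡⟨ cong (λ t → e (Profile.prev t) ∷ []) profileIn-drop ⟨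
    e (Profile.prev (profileIn w (drop i w))) ∷ []        ∎
    where
    open ≡-Reasoning
    profileIn-drop : profileIn w (drop i w) ≡ profileOf (take i w) (drop i w)
    profileIn-drop = ≡.subst (λ w′ → profileIn w′ (drop i w) ≡ profileOf (take i w) (drop i w))
                             (take++drop≡id i w) (profileIn-++ (take i w) (drop i w))

  lexLt-conj : ∀ i j → i < length w → j < length w → i ≢ j →
               lexLt (conj i wF) (conj j wF) ≡ lexOn e (drop i w) (drop j w)
  lexLt-conj i j i<w j<w i≢j = begin
    lexLt (conj i wF) (conj j wF)
      ≡⟨ cong₂ lexLt (conj-sentinel i i<w) (conj-sentinel j j<w) ⟩
    lexLt (map e (drop i v) ++ x ∷ map e (take i w)) (map e (drop j v) ++ x ∷ map e (take j w))
      ≡⟨ lexLt-sentinel (map e (drop i v)) (map e (drop j v)) _ _ (≢x i) (≢x j) (i≢j ∘ drop-injective′) ⟩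
    lexLt (map e (drop i v) ∷ʳ x) (map e (drop j v) ∷ʳ x)
      ≡⟨ cong₂ lexLt (map-drop i i<w) (map-drop j j<w) ⟨
    lexOn e (drop i w) (drop j w) ∎
    where
    open ≡-Reasoning
    ≢x : ∀ k → All (_≢ x) (map e (drop k v))
    ≢x k = map⁺ (All.map (λ { isA → a≢x ; isB → b≢x }) (drop⁺ k v-AB))
    drop-injective′ : map e (drop i v) ≡ map e (drop j v) → i ≡ j
    drop-injective′ = drop-injective v (<-length-∷ʳ v X i<w) (<-length-∷ʳ v X j<w) ∘ map-injective (embed-injective d)
    map-drop : ∀ k → k < length w → map e (drop k w) ≡ map e (drop k v) ∷ʳ x
    map-drop k k<w = ≡.trans (cong (map e) (drop-∷ʳ k v X (<-length-∷ʳ v X k<w))) (map-++ e (drop k v) (X ∷ []))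

  pairLeq-suffixAt : ∀ {p q} → Rotation p → Rotation q → not (lexOn e (suffixAt q) (suffixAt p)) ≡ pairLeq p q
  pairLeq-suffixAt {i , _} {j , _} (i<w , refl) (j<w , refl) with i ℕ.≟ j
  ... | yes refl rewrite L.irrefl (drop i w) | IsStrictTotalᵇ.irrefl lexLt-isStrictTotal (conj i wF)
                       | isYes-true (i ℕ.≤? i) ℕ.≤-refl = refl
  ... | no i≢j rewrite lexLt-conj i j i<w j<w i≢j | lexLt-conj j i j<w i<w (i≢j ∘ sym)
    with lexOn e (drop i w) (drop j w) in i<j
  ...   | true rewrite L.asym (drop i w) (drop j w) i<j = refl
  ...   | false with lexOn e (drop j w) (drop i w) in j<i
  ...     | true = refl
  ...     | false = ⊥-elim (i≢j (drop-injective w (ℕ.<⇒≤ i<w) (ℕ.<⇒≤ j<w) (L.tri (drop i w) (drop j w) i<j j<i)))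

  BWT-profiles : BWT wF ≡ map (e ∘ Profile.prev) (profiles e v)
  BWT-profiles = begin
    concatMap (lastL ∘ proj₂) (sort rotations)
      ≡⟨ cong (concatMap (lastL ∘ proj₂)) (sort≡sortBy rotations) ⟩
    concatMap (lastL ∘ proj₂) (sortBy pairLeq rotations)
      ≡⟨ concatMap-singletons (sortBy-All pairLeq (All.map lastL-conj rotations-valid)) ⟩
    map (prevLetter ∘ suffixAt) (sortBy pairLeq rotations)
      ≡⟨ map-∘ (sortBy pairLeq rotations) ⟩
    map prevLetter (map suffixAt (sortBy pairLeq rotations))
      ≡⟨ cong (map prevLetter) (sortBy-map suffixAt pairLeq-suffixAt rotations-valid) ⟨
    map prevLetter (sortOn e (map suffixAt rotations))
      ≡⟨ cong (λ ks → map prevLetter (sortOn e ks)) map-suffixAt ⟩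
    map prevLetter (sortOn e (suffixes w))
      ≡⟨ map-∘ (sortOn e (suffixes w)) ⟩
    map (e ∘ Profile.prev) (profiles e v) ∎
    where
    open ≡-Reasoning
    rotations = map (λ i → (i , conj i wF)) (upTo (length wF))
    prevLetter = e ∘ Profile.prev ∘ profileIn w
    rotations-valid : All Rotation rotations
    rotations-valid = map⁺ (applyUpTo⁺₁ (λ i → i) (length wF) (λ i<wF → ≡.subst (_ <_) (length-map e w) i<wF , refl))
    map-suffixAt : map suffixAt rotations ≡ suffixes w
    map-suffixAt = begin
      map suffixAt rotations                              ≡⟨ map-∘ (upTo (length wF)) ⟨
      map (λ i → drop i w) (upTo (length wF))             ≡⟨ cong (map (λ i → drop i w) ∘ upTo) (length-map e w) ⟩
      map (λ i → drop i w) (upTo (length w))              ≡⟨ map-applyUpTo (λ i → i) (λ i → drop i w) (length w) ⟩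
      applyUpTo (λ i → drop i w) (length w)               ≡⟨ applyUpTo-drop w ⟩
      suffixes w                                          ∎

-- Sorting the suffixes of φ (v X)

startsWithA : List Letter → Bool
startsWithA (A ∷ _) = true
startsWithA _ = false

Aφ : List Letter → List Letter
Aφ k = A ∷ φ k

suffixes-φ : ∀ {v} → All IsAB v →
             suffixes (φ (v ∷ʳ X)) ↭ map Aφ (suffixes (drop 1 (v ∷ʳ X)))
                                     ++ map φ (filterᵇ startsWithA (suffixes (v ∷ʳ X)))
                                     ++ (X ∷ []) ∷ []
suffixes-φ [] = ↭-refl
suffixes-φ {A ∷ v} (isA ∷ v-AB) = begin
    φ (A ∷ w) ∷ Aφ w ∷ suffixes (φ w)
      ↭⟨ ↭-swap _ _ (suffixes-φ v-AB) ⟩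
    Aφ w ∷ φ (A ∷ w) ∷ (As ++ Bs ++ XX)
      ↭⟨ ↭-prep _ (↭-sym (shift (φ (A ∷ w)) As (Bs ++ XX))) ⟩
    Aφ w ∷ (As ++ φ (A ∷ w) ∷ Bs ++ XX)
      ≡⟨ cong (λ S → map Aφ S ++ φ (A ∷ w) ∷ Bs ++ XX) (suffixes-∷ʳ v X) ⟨
    map Aφ (suffixes w) ++ φ (A ∷ w) ∷ Bs ++ XX ∎
  where
  open PermutationReasoning
  w = v ∷ʳ X
  As = map Aφ (suffixes (drop 1 w))
  Bs = map φ (filterᵇ startsWithA (suffixes w))
  XX = (X ∷ []) ∷ []
suffixes-φ {B ∷ v} (isB ∷ v-AB) = begin
    Aφ w ∷ suffixes (φ w)    ↭⟨ ↭-prep _ (suffixes-φ v-AB) ⟩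
    Aφ w ∷ (As ++ Bs ++ XX)  ≡⟨ cong (λ S → map Aφ S ++ Bs ++ XX) (suffixes-∷ʳ v X) ⟨
    map Aφ (suffixes w) ++ Bs ++ XX ∎
  where
  open PermutationReasoning
  w = v ∷ʳ X
  As = map Aφ (suffixes (drop 1 w))
  Bs = map φ (filterᵇ startsWithA (suffixes w))
  XX = (X ∷ []) ∷ []

StartsWith : Letter → List Letter → Set
StartsWith c k = ∃[ k′ ] k ≡ c ∷ k′

-- The order in which the blocks of suffixes starting with A, B and X appear.
data BlockOrder : Set where
  ABX BAX XAB XBA : BlockOrder

arrange : ∀ {T : Set} → BlockOrder → List T → List T → List T → List T
arrange ABX as bs xs = as ++ bs ++ xs
arrange BAX as bs xs = bs ++ as ++ xs
arrange XAB as bs xs = xs ++ as ++ bs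
arrange XBA as bs xs = xs ++ bs ++ as

arrange-↭ : ∀ {T : Set} o (as bs xs : List T) → as ++ bs ++ xs ↭ arrange o as bs xs
arrange-↭ ABX as bs xs = ↭-refl
arrange-↭ BAX as bs xs = shifts as bs
arrange-↭ XAB as bs xs = ↭-trans (↭-reflexive (sym (++-assoc as bs xs))) (++-comm (as ++ bs) xs)
arrange-↭ XBA as bs xs = ↭-trans (shifts as bs) (arrange-↭ XAB bs as xs)

module _ {n : ℕ} where

  BlocksOrdered : (Letter → Fin n) → BlockOrder → Set
  BlocksOrdered e ABX = e A <ᶠ e B × e B <ᶠ e X
  BlocksOrdered e BAX = e B <ᶠ e A × e A <ᶠ e X
  BlocksOrdered e XAB = e X <ᶠ e A × e A <ᶠ e B
  BlocksOrdered e XBA = e X <ᶠ e B × e B <ᶠ e A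

module SuffixSort {n : ℕ} {e : Letter → Fin n} (e-inj : Injective _≡_ _≡_ e) where
  open StrictTotalSort (lexOn-isStrictTotal e-inj) public

  blocks-< : ∀ {c d U V} → e c <ᶠ e d → All (StartsWith c) U → All (StartsWith d) V →
             All (λ u → All (λ v → lexOn e u v ≡ true) V) U
  blocks-< c<d U-c V-d =
    All.map (λ { (u′ , refl) → All.map (λ { (v′ , refl) → lexLt-< (map e u′) (map e v′) c<d }) V-d }) U-c

  sort-blocks : ∀ {c₁ c₂ c₃ U₁ U₂ U₃} → e c₁ <ᶠ e c₂ → e c₂ <ᶠ e c₃ →
                All (StartsWith c₁) U₁ → All (StartsWith c₂) U₂ → All (StartsWith c₃) U₃ →
                sortOn e (U₁ ++ U₂ ++ U₃) ≡ sortOn e U₁ ++ sortOn e U₂ ++ sortOn e U₃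
  sort-blocks {U₁ = U₁} {U₂} {U₃} c₁<c₂ c₂<c₃ h₁ h₂ h₃ =
    ≡.trans (sort-++ U₁ (U₂ ++ U₃) (All.zipWith (λ (p , q) → ++⁺ p q)
                                      (blocks-< c₁<c₂ h₁ h₂ , blocks-< (Finₚ.<-trans c₁<c₂ c₂<c₃) h₁ h₃)))
            (cong (sortOn e U₁ ++_) (sort-++ U₂ U₃ (blocks-< c₂<c₃ h₂ h₃)))

  sort-arrange : ∀ o {as bs xs} → BlocksOrdered e o →
                 All (StartsWith A) as → All (StartsWith B) bs → All (StartsWith X) xs →
                 sortOn e (arrange o as bs xs) ≡ arrange o (sortOn e as) (sortOn e bs) (sortOn e xs)
  sort-arrange ABX (<₁ , <₂) as-A bs-B xs-X = sort-blocks <₁ <₂ as-A bs-B xs-X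
  sort-arrange BAX (<₁ , <₂) as-A bs-B xs-X = sort-blocks <₁ <₂ bs-B as-A xs-X
  sort-arrange XAB (<₁ , <₂) as-A bs-B xs-X = sort-blocks <₁ <₂ xs-X as-A bs-B
  sort-arrange XBA (<₁ , <₂) as-A bs-B xs-X = sort-blocks <₁ <₂ xs-X bs-B as-A

module _ {n : ℕ} {a b x : Fin n} (d : Distinct a b x) where

  sortOn-φ : ∀ ks → sortOn (embed a b x) (map φ ks) ≡ map φ (sortOn (embed b a x) ks)
  sortOn-φ ks = sortBy-map φ (λ {u} {v} _ _ → cong not (φ-lexOn d v u)) (All.universal (λ _ → tt) ks)

  sortOn-Aφ : ∀ ks → sortOn (embed a b x) (map Aφ ks) ≡ map Aφ (sortOn (embed b a x) ks)
  sortOn-Aφ ks = sortBy-map Aφ (λ {u} {v} _ _ → cong not (Aφ-lexOn v u)) (All.universal (λ _ → tt) ks)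
    where
    Aφ-lexOn : ∀ u v → lexOn (embed a b x) (Aφ u) (Aφ v) ≡ lexOn (embed b a x) u v
    Aφ-lexOn u v = ≡.trans (lexLt-≡ a (map (embed a b x) (φ u)) (map (embed a b x) (φ v))) (φ-lexOn d u v)

concatMap-filter : ∀ {T U : Set} {g : T → List U} {h : T → U} (p : T → Bool) {xs} →
                   All (λ x → g x ≡ (if p x then h x ∷ [] else [])) xs → concatMap g xs ≡ map h (filterᵇ p xs)
concatMap-filter p [] = refl
concatMap-filter p {x ∷ _} (gx ∷ gxs) with p x
... | true = cong₂ _++_ gx (concatMap-filter p gxs)
... | false = cong₂ _++_ gx (concatMap-filter p gxs)

map-arrange : ∀ {T U : Set} (f : T → U) o as bs xs →
              map f (arrange o as bs xs) ≡ arrange o (map f as) (map f bs) (map f xs)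
map-arrange f ABX as bs xs = ≡.trans (map-++ f as _) (cong (map f as ++_) (map-++ f bs xs))
map-arrange f BAX as bs xs = ≡.trans (map-++ f bs _) (cong (map f bs ++_) (map-++ f as xs))
map-arrange f XAB as bs xs = ≡.trans (map-++ f xs _) (cong (map f xs ++_) (map-++ f as bs))
map-arrange f XBA as bs xs = ≡.trans (map-++ f xs _) (cong (map f xs ++_) (map-++ f bs as))

-- A proper suffix k of w yields the suffix A φ k of φ w, and a suffix k starting with A
-- also yields φ k; nextA and nextB give the profiles of these from that of k. Only the
-- whole word is preceded by X, and a prefix B B of w is excluded (it would make A φ k
-- start at position 1).
nextA : Profile → List Profile
nextA (profile A _ _ first) = profile B A false first ∷ []
nextA (profile B _ _ first) = profile (if first then X else A) A first false ∷ []
nextA (profile X _ _ _) = []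

nextB : Profile → List Profile
nextB (profile _ B _ _) = []
nextB (profile _ X _ _) = []
nextB (profile B A whole first) = profile (if whole then X else A) B whole first ∷ []
nextB (profile _ A whole _) = profile (if whole then X else A) B whole false ∷ []

lastOr-A-φ : ∀ {u} → All IsAB u → lastOr A (φ u) ≡ A
lastOr-A-φ [] = refl
lastOr-A-φ (isA ∷ u-AB) = lastOr-A-φ u-AB
lastOr-A-φ (isB ∷ u-AB) = lastOr-A-φ u-AB

lastOr-φ : ∀ {u} → All IsAB u → lastOr X (φ u) ≡ (if null u then X else A)
lastOr-φ [] = refl
lastOr-φ (isA ∷ u-AB) = lastOr-A-φ u-AB
lastOr-φ (isB ∷ u-AB) = lastOr-A-φ u-AB

null-φ : ∀ u → null (φ u) ≡ null u
null-φ [] = refl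
null-φ (A ∷ _) = refl
null-φ (B ∷ _) = refl
null-φ (X ∷ _) = refl

isSingleton-φ : ∀ {u} → All IsAB u → u ≢ B ∷ [] → isSingleton (φ u) ≡ false
isSingleton-φ [] _ = refl
isSingleton-φ (isA ∷ _) _ = refl
isSingleton-φ (isB ∷ []) u≢B = ⊥-elim (u≢B refl)
isSingleton-φ (isB ∷ isA ∷ _) _ = refl
isSingleton-φ (isB ∷ isB ∷ _) _ = refl

φ-∷ʳ-++ : ∀ u c k → φ ((u ∷ʳ c) ++ k) ≡ φ u ++ φ (c ∷ k)
φ-∷ʳ-++ u c k = ≡.trans (cong φ (∷ʳ-++ u c k)) (φ-++ u (c ∷ k))

profileIn-Aφ : ∀ {u c} k → All IsAB u → IsAB c → u ∷ʳ c ≢ B ∷ B ∷ [] →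
               nextA (profileIn ((u ∷ʳ c) ++ k) k) ≡ profileIn (φ ((u ∷ʳ c) ++ k)) (Aφ k) ∷ []
profileIn-Aφ {u} {A} k u-AB isA _ = begin
  nextA (profileIn ((u ∷ʳ A) ++ k) k)
    ≡⟨ cong nextA (≡.trans (profileIn-++ (u ∷ʳ A) k) (profileOf-∷ʳ u A k)) ⟩
  profile B A false (null u) ∷ []
    ≡⟨ cong (λ z → profile B A false z ∷ []) (null-φ u) ⟨
  profile B A false (null (φ u)) ∷ []
    ≡⟨ cong (_∷ []) (≡.trans (profileIn-++ (φ u ∷ʳ B) (Aφ k)) (profileOf-∷ʳ (φ u) B (Aφ k))) ⟨
  profileIn ((φ u ∷ʳ B) ++ Aφ k) (Aφ k) ∷ []
    ≡⟨ cong (λ w → profileIn w (Aφ k) ∷ []) (≡.trans (∷ʳ-++ (φ u) B (Aφ k)) (sym (φ-∷ʳ-++ u A k))) ⟩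
  profileIn (φ ((u ∷ʳ A) ++ k)) (Aφ k) ∷ [] ∎
  where open ≡-Reasoning
profileIn-Aφ {u} {B} k u-AB isB uB≢BB = begin
  nextA (profileIn ((u ∷ʳ B) ++ k) k)
    ≡⟨ cong nextA (≡.trans (profileIn-++ (u ∷ʳ B) k) (profileOf-∷ʳ u B k)) ⟩
  profile (if null u then X else A) A (null u) false ∷ []
    ≡⟨ cong₂ (λ p z → profile p A z false ∷ []) (lastOr-φ u-AB) (null-φ u) ⟨
  profile (lastOr X (φ u)) A (null (φ u)) false ∷ []
    ≡⟨ cong (λ z → profile (lastOr X (φ u)) A (null (φ u)) z ∷ []) (isSingleton-φ u-AB (uB≢BB ∘ cong (_∷ʳ B))) ⟨
  profileOf (φ u) (Aφ k) ∷ []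
    ≡⟨ cong (_∷ []) (profileIn-++ (φ u) (Aφ k)) ⟨
  profileIn (φ u ++ Aφ k) (Aφ k) ∷ []
    ≡⟨ cong (λ w → profileIn w (Aφ k) ∷ []) (φ-∷ʳ-++ u B k) ⟨
  profileIn (φ ((u ∷ʳ B) ++ k)) (Aφ k) ∷ [] ∎
  where open ≡-Reasoning

nextB-profileOf : ∀ {u} k → All IsAB u →
                  nextB (profileOf u k) ≡ (if startsWithA k then profileOf (φ u) (φ k) ∷ [] else [])
nextB-profileOf [] _ = refl
nextB-profileOf (B ∷ _) _ = refl
nextB-profileOf (X ∷ _) _ = refl
nextB-profileOf {u} (A ∷ k) u-AB with initLast u
... | [] = refl
... | u′ ∷ʳ′ c with ++⁻ʳ u′ u-AB
...   | isA ∷ [] = begin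
  nextB (profileOf (u′ ∷ʳ A) (A ∷ k))
    ≡⟨ cong nextB (profileOf-∷ʳ u′ A (A ∷ k)) ⟩
  profile A B false false ∷ []
    ≡⟨ cong (λ z → profile A B false z ∷ []) (null-∷ʳ (φ u′) B) ⟨
  profile A B false (null (φ u′ ∷ʳ B)) ∷ []
    ≡⟨ cong (_∷ []) (profileOf-∷ʳ (φ u′ ∷ʳ B) A (φ (A ∷ k))) ⟨
  profileOf ((φ u′ ∷ʳ B) ∷ʳ A) (φ (A ∷ k)) ∷ []
    ≡⟨ cong (λ p → profileOf p (φ (A ∷ k)) ∷ [])
            (≡.trans (++-assoc (φ u′) (B ∷ []) (A ∷ [])) (sym (φ-++ u′ (A ∷ [])))) ⟩
  profileOf (φ (u′ ∷ʳ A)) (φ (A ∷ k)) ∷ [] ∎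
  where open ≡-Reasoning
...   | isB ∷ [] = begin
  nextB (profileOf (u′ ∷ʳ B) (A ∷ k))
    ≡⟨ cong nextB (profileOf-∷ʳ u′ B (A ∷ k)) ⟩
  profile A B false (null u′) ∷ []
    ≡⟨ cong (λ z → profile A B false z ∷ []) (null-φ u′) ⟨
  profile A B false (null (φ u′)) ∷ []
    ≡⟨ cong (_∷ []) (profileOf-∷ʳ (φ u′) A (φ (A ∷ k))) ⟨
  profileOf (φ u′ ∷ʳ A) (φ (A ∷ k)) ∷ []
    ≡⟨ cong (λ p → profileOf p (φ (A ∷ k)) ∷ []) (φ-++ u′ (B ∷ [])) ⟨
  profileOf (φ (u′ ∷ʳ B)) (φ (A ∷ k)) ∷ [] ∎
  where open ≡-Reasoning

profileIn-φ : ∀ {u} k → All IsAB u →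
              nextB (profileIn (u ++ k) k) ≡ (if startsWithA k then profileIn (φ (u ++ k)) (φ k) ∷ [] else [])
profileIn-φ {u} k u-AB = begin
  nextB (profileIn (u ++ k) k)
    ≡⟨ cong nextB (profileIn-++ u k) ⟩
  nextB (profileOf u k)
    ≡⟨ nextB-profileOf k u-AB ⟩
  (if startsWithA k then profileOf (φ u) (φ k) ∷ [] else [])
    ≡⟨ cong (λ t → if startsWithA k then t ∷ [] else []) profileIn-φ-k ⟨
  (if startsWithA k then profileIn (φ (u ++ k)) (φ k) ∷ [] else []) ∎
  where
  open ≡-Reasoning
  profileIn-φ-k : profileIn (φ (u ++ k)) (φ k) ≡ profileOf (φ u) (φ k)
  profileIn-φ-k = ≡.trans (cong (λ w → profileIn w (φ k)) (φ-++ u k)) (profileIn-++ (φ u) (φ k))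

ProperSplit : List Letter → List Letter → Set
ProperSplit w k = ∃[ u ] ∃[ c ] (All IsAB u × IsAB c × w ≡ (u ∷ʳ c) ++ k)

Split : List Letter → List Letter → Set
Split w k = ∃[ u ] (All IsAB u × w ≡ u ++ k)

properSuffixes-split : ∀ {v} → All IsAB v → All (ProperSplit (v ∷ʳ X)) (suffixes (drop 1 (v ∷ʳ X)))
properSuffixes-split [] = []
properSuffixes-split {c ∷ v} (c-AB ∷ v-AB) =
  ≡.subst (All (ProperSplit (c ∷ v ∷ʳ X))) (sym (suffixes-∷ʳ v X))
    (([] , c , [] , c-AB , refl) ∷ All.map extend (properSuffixes-split v-AB))
  where
  extend : ∀ {k} → ProperSplit (v ∷ʳ X) k → ProperSplit (c ∷ v ∷ʳ X) k
  extend (u , c′ , u-AB , c′-AB , eq) = c ∷ u , c′ , c-AB ∷ u-AB , c′-AB , cong (c ∷_) eq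

suffixes-split : ∀ {v} → All IsAB v → All (Split (v ∷ʳ X)) (suffixes (v ∷ʳ X))
suffixes-split {v} v-AB =
  ≡.subst (All (Split (v ∷ʳ X))) (sym (suffixes-∷ʳ v X))
    (([] , [] , refl) ∷ All.map forget (properSuffixes-split v-AB))
  where
  forget : ∀ {k} → ProperSplit (v ∷ʳ X) k → Split (v ∷ʳ X) k
  forget (u , c , u-AB , c-AB , eq) = u ∷ʳ c , ∷ʳ⁺ u-AB c-AB , eq

data Admissible : List Letter → Set where
  admissible : ∀ {c d v} → All IsAB (c ∷ d ∷ v) → ¬ (c ≡ B × d ≡ B) → Admissible (c ∷ d ∷ v)

φ-AB : ∀ {u} → All IsAB u → All IsAB (φ u)
φ-AB [] = []
φ-AB (isA ∷ u-AB) = isB ∷ isA ∷ φ-AB u-AB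
φ-AB (isB ∷ u-AB) = isA ∷ φ-AB u-AB

φ-admissible : ∀ {v} → Admissible v → Admissible (φ v)
φ-admissible (admissible (isA ∷ d-AB ∷ v-AB) _) = admissible (isB ∷ isA ∷ φ-AB (d-AB ∷ v-AB)) λ { (_ , ()) }
φ-admissible (admissible (isB ∷ isA ∷ v-AB) _) = admissible (isA ∷ isB ∷ isA ∷ φ-AB v-AB) λ { (() , _) }
φ-admissible (admissible (isB ∷ isB ∷ _) ¬BB) = ⊥-elim (¬BB (refl , refl))

φProfiles : BlockOrder → List Profile → List Profile
φProfiles o Π = arrange o (concatMap nextA Π) (concatMap nextB Π) (profile A X false false ∷ [])

profileIn-sentinel : ∀ {v} → Admissible v → profileIn (φ (v ∷ʳ X)) (X ∷ []) ≡ profile A X false false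
profileIn-sentinel {v} (admissible v-AB _) = begin
  profileIn (φ (v ∷ʳ X)) (X ∷ [])
    ≡⟨ cong (λ W → profileIn W (X ∷ [])) (φ-++ v (X ∷ [])) ⟩
  profileIn (φ v ∷ʳ X) (X ∷ [])
    ≡⟨ profileIn-++ (φ v) (X ∷ []) ⟩
  profileOf (φ v) (X ∷ [])
    ≡⟨ cong₂ (λ p z → profile p X z (isSingleton (φ v))) (lastOr-φ v-AB) (null-φ v) ⟩
  profile A X false (isSingleton (φ v))
    ≡⟨ cong (profile A X false) (isSingleton-φ v-AB λ ()) ⟩
  profile A X false false ∎
  where open ≡-Reasoning

module _ {n : ℕ} {a b x : Fin n} (d : Distinct a b x) where
  private
    e e′ : Letter → Fin n
    e = embed a b x
    e′ = embed b a x
    module S = SuffixSort (embed-injective d)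
    module S′ = SuffixSort (embed-injective (swapDistinct d))

  nextA-profiles : ∀ {v} → Admissible v →
                   concatMap nextA (profiles e′ v)
                     ≡ map (profileIn (φ (v ∷ʳ X))) (map Aφ (sortOn e′ (suffixes (drop 1 (v ∷ʳ X)))))
  nextA-profiles {v@(c₀ ∷ d₀ ∷ _)} (admissible v-AB ¬BB) = begin
    concatMap nextA (map (profileIn w) (sortOn e′ (suffixes w)))
      ≡⟨ concatMap-map nextA (profileIn w) (sortOn e′ (suffixes w)) ⟩
    concatMap (nextA ∘ profileIn w) (sortOn e′ (suffixes w))
      ≡⟨ concatMap-insertBy _ (nextA ∘ profileIn w) w Ts (cong nextA (profileIn-++ [] w)) ⟩
    concatMap (nextA ∘ profileIn w) Ts
      ≡⟨ concatMap-singletons (sortBy-All _ (All.map proper (properSuffixes-split v-AB))) ⟩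
    map (profileIn (φ w) ∘ Aφ) Ts
      ≡⟨ map-∘ Ts ⟩
    map (profileIn (φ w)) (map Aφ Ts) ∎
    where
    open ≡-Reasoning
    w = v ∷ʳ X
    Ts = sortOn e′ (suffixes (drop 1 w))
    proper : ∀ {k} → ProperSplit w k → nextA (profileIn w k) ≡ profileIn (φ w) (Aφ k) ∷ []
    proper {k} (u , c , u-AB , c-AB , eq) =
      ≡.subst (λ w → nextA (profileIn w k) ≡ profileIn (φ w) (Aφ k) ∷ []) (sym eq)
        (profileIn-Aφ k u-AB c-AB λ uc≡BB → ¬BB (initial-BB (≡.trans eq (cong (_++ k) uc≡BB))))
      where
      initial-BB : ∀ {r} → _≡_ {A = List Letter} (c₀ ∷ d₀ ∷ r) (B ∷ B ∷ k) → c₀ ≡ B × d₀ ≡ B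
      initial-BB refl = refl , refl

  nextB-profiles : ∀ {v} → All IsAB v →
                   concatMap nextB (profiles e′ v)
                     ≡ map (profileIn (φ (v ∷ʳ X))) (map φ (filterᵇ startsWithA (sortOn e′ (suffixes (v ∷ʳ X)))))
  nextB-profiles {v} v-AB = begin
    concatMap nextB (map (profileIn w) SL)
      ≡⟨ concatMap-map nextB (profileIn w) SL ⟩
    concatMap (nextB ∘ profileIn w) SL
      ≡⟨ concatMap-filter startsWithA (sortBy-All _ (All.map split (suffixes-split v-AB))) ⟩
    map (profileIn (φ w) ∘ φ) (filterᵇ startsWithA SL)
      ≡⟨ map-∘ (filterᵇ startsWithA SL) ⟩
    map (profileIn (φ w)) (map φ (filterᵇ startsWithA SL)) ∎
    where
    open ≡-Reasoning
    w = v ∷ʳ X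
    SL = sortOn e′ (suffixes w)
    split : ∀ {k} → Split w k → nextB (profileIn w k) ≡ (if startsWithA k then profileIn (φ w) (φ k) ∷ [] else [])
    split {k} (u , u-AB , eq) =
      ≡.subst (λ w → nextB (profileIn w k) ≡ (if startsWithA k then profileIn (φ w) (φ k) ∷ [] else []))
        (sym eq) (profileIn-φ k u-AB)

  profiles-φ : ∀ {o v} → BlocksOrdered e o → Admissible v → profiles e (φ v) ≡ φProfiles o (profiles e′ v)
  profiles-φ {o} {v} ordered v-adm@(admissible v-AB _) = begin
    map (profileIn (φ v ∷ʳ X)) (sortOn e (suffixes (φ v ∷ʳ X)))
      ≡⟨ cong (λ W → map (profileIn W) (sortOn e (suffixes W))) (φ-++ v (X ∷ [])) ⟨
    map (profileIn W) (sortOn e (suffixes W))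
      ≡⟨ cong (map (profileIn W)) (S.sort-↭ (↭-trans (suffixes-φ v-AB) (arrange-↭ o As Bs XX))) ⟩
    map (profileIn W) (sortOn e (arrange o As Bs XX))
      ≡⟨ cong (map (profileIn W)) (S.sort-arrange o ordered As-A Bs-B ((_ , refl) ∷ [])) ⟩
    map (profileIn W) (arrange o (sortOn e As) (sortOn e Bs) XX)
      ≡⟨ cong₂ (λ as bs → map (profileIn W) (arrange o as bs XX)) (sortOn-Aφ d P) sort-Bs ⟩
    map (profileIn W) (arrange o (map Aφ Ts) (map φ (filterᵇ startsWithA SL)) XX)
      ≡⟨ map-arrange (profileIn W) o _ _ XX ⟩
    arrange o (map (profileIn W) (map Aφ Ts)) (map (profileIn W) (map φ (filterᵇ startsWithA SL)))
              (profileIn W (X ∷ []) ∷ [])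
      ≡⟨ cong₂ (λ as bs → arrange o as bs (profileIn W (X ∷ []) ∷ [])) (nextA-profiles v-adm) (nextB-profiles v-AB) ⟨
    arrange o (concatMap nextA (profiles e′ v)) (concatMap nextB (profiles e′ v)) (profileIn W (X ∷ []) ∷ [])
      ≡⟨ cong (λ t → arrange o (concatMap nextA (profiles e′ v)) (concatMap nextB (profiles e′ v)) (t ∷ []))
              (profileIn-sentinel v-adm) ⟩
    φProfiles o (profiles e′ v) ∎
    where
    open ≡-Reasoning
    w = v ∷ʳ X
    W = φ w
    P = suffixes (drop 1 w)
    Ts = sortOn e′ P
    SL = sortOn e′ (suffixes w)
    As = map Aφ P
    Bs = map φ (filterᵇ startsWithA (suffixes w))
    XX = (X ∷ []) ∷ []
    As-A : All (StartsWith A) As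
    As-A = map⁺ (All.universal (λ k → φ k , refl) P)
    Bs-B : All (StartsWith B) Bs
    Bs-B = map⁺ (All.map starts-B (all-filter (T? ∘ startsWithA) (suffixes w)))
      where
      starts-B : ∀ {k} → T (startsWithA k) → StartsWith B (φ k)
      starts-B {A ∷ k} _ = A ∷ φ k , refl
    sort-Bs : sortOn e Bs ≡ map φ (filterᵇ startsWithA SL)
    sort-Bs = ≡.trans (sortOn-φ d (filterᵇ startsWithA (suffixes w)))
                      (cong (map φ) (S′.sort-filter startsWithA (suffixes w)))

-- Run-length shapes of profile sequences

groupsR : ∀ {T : Set} → T → T → List ℕ → List T → List T
groupsR x y [] t = t
groupsR x y (c ∷ cs) t = replicate (suc c) x ++ y ∷ groupsR x y cs t

groupsL : ∀ {T : Set} → T → T → List ℕ → List T → List T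
groupsL y x [] t = t
groupsL y x (c ∷ cs) t = y ∷ replicate (suc c) x ++ groupsL y x cs t

groupsSize : List ℕ → ℕ
groupsSize [] = 0
groupsSize (c ∷ cs) = suc c + suc (groupsSize cs)

module _ {T : Set} where

  replicate-++-replicate : ∀ m n (z : T) t → replicate m z ++ replicate n z ++ t ≡ replicate (m + n) z ++ t
  replicate-++-replicate zero n z t = refl
  replicate-++-replicate (suc m) n z t = cong (z ∷_) (replicate-++-replicate m n z t)

  replicate-∷ : ∀ n (z : T) t → replicate n z ++ z ∷ t ≡ replicate (suc n) z ++ t
  replicate-∷ n z t = ≡.trans (replicate-++-replicate n 1 z t) (cong (λ m → replicate m z ++ t) (+-comm n 1))

  groupsR-same : ∀ (z : T) cs t → groupsR z z cs t ≡ replicate (groupsSize cs) z ++ t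
  groupsR-same z [] t = refl
  groupsR-same z (c ∷ cs) t = ≡.trans (cong (λ u → replicate (suc c) z ++ z ∷ u) (groupsR-same z cs t))
                                      (replicate-++-replicate (suc c) (suc (groupsSize cs)) z t)

  groupsL-same : ∀ (z : T) cs t → groupsL z z cs t ≡ replicate (groupsSize cs) z ++ t
  groupsL-same z [] t = refl
  groupsL-same z (c ∷ cs) t = begin
    z ∷ replicate (suc c) z ++ groupsL z z cs t
      ≡⟨ cong (λ u → z ∷ replicate (suc c) z ++ u) (groupsL-same z cs t) ⟩
    replicate (suc (suc c)) z ++ replicate (groupsSize cs) z ++ t
      ≡⟨ replicate-++-replicate (suc (suc c)) (groupsSize cs) z t ⟩
    replicate (suc (suc c) + groupsSize cs) z ++ t
      ≡⟨ cong (λ m → replicate (suc m) z ++ t) (+-suc c (groupsSize cs)) ⟨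
    replicate (suc c + suc (groupsSize cs)) z ++ t ∎
    where open ≡-Reasoning

  groupsR-++ : ∀ (x y : T) cs t u → groupsR x y cs t ++ u ≡ groupsR x y cs (t ++ u)
  groupsR-++ x y [] t u = refl
  groupsR-++ x y (c ∷ cs) t u =
    ≡.trans (++-assoc (replicate (suc c) x) _ u) (cong (λ r → replicate (suc c) x ++ y ∷ r) (groupsR-++ x y cs t u))

  groupsL-++ : ∀ (y x : T) cs t u → groupsL y x cs t ++ u ≡ groupsL y x cs (t ++ u)
  groupsL-++ y x [] t u = refl
  groupsL-++ y x (c ∷ cs) t u =
    cong (y ∷_) (≡.trans (++-assoc (replicate (suc c) x) _ u) (cong (replicate (suc c) x ++_) (groupsL-++ y x cs t u)))

  groupsR-∷ʳ : ∀ (x y : T) cs c t → groupsR x y (cs ∷ʳ c) t ≡ groupsR x y cs (replicate (suc c) x ++ y ∷ t)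
  groupsR-∷ʳ x y [] c t = refl
  groupsR-∷ʳ x y (d ∷ cs) c t = cong (λ r → replicate (suc d) x ++ y ∷ r) (groupsR-∷ʳ x y cs c t)

  module _ {U : Set} (κ : T → List U) where

    concatMap-replicate : ∀ {z′} n z t → κ z ≡ z′ ∷ [] →
                          concatMap κ (replicate n z ++ t) ≡ replicate n z′ ++ concatMap κ t
    concatMap-replicate zero z t _ = refl
    concatMap-replicate (suc n) z t κz = cong₂ _++_ κz (concatMap-replicate n z t κz)

    concatMap-replicate-[] : ∀ n z t → κ z ≡ [] → concatMap κ (replicate n z ++ t) ≡ concatMap κ t
    concatMap-replicate-[] zero z t _ = refl
    concatMap-replicate-[] (suc n) z t κz = cong₂ _++_ κz (concatMap-replicate-[] n z t κz)

    concatMap-groupsR : ∀ {x x′ y y′} cs t → κ x ≡ x′ ∷ [] → κ y ≡ y′ ∷ [] →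
                        concatMap κ (groupsR x y cs t) ≡ groupsR x′ y′ cs (concatMap κ t)
    concatMap-groupsR [] t _ _ = refl
    concatMap-groupsR {x} {x′} {y} {y′} (c ∷ cs) t κx κy = begin
      concatMap κ (replicate (suc c) x ++ y ∷ groupsR x y cs t)   ≡⟨ concatMap-replicate (suc c) x _ κx ⟩
      replicate (suc c) x′ ++ κ y ++ concatMap κ (groupsR x y cs t) ≡⟨ cong (λ r → replicate (suc c) x′ ++ r)
                                                                        (cong₂ _++_ κy (concatMap-groupsR cs t κx κy)) ⟩
      replicate (suc c) x′ ++ y′ ∷ groupsR x′ y′ cs (concatMap κ t) ∎
      where open ≡-Reasoning

    concatMap-groupsL : ∀ {x x′ y y′} cs t → κ y ≡ y′ ∷ [] → κ x ≡ x′ ∷ [] →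
                        concatMap κ (groupsL y x cs t) ≡ groupsL y′ x′ cs (concatMap κ t)
    concatMap-groupsL [] t _ _ = refl
    concatMap-groupsL {x} {x′} {y} {y′} (c ∷ cs) t κy κx =
      cong₂ _++_ κy (≡.trans (concatMap-replicate (suc c) x _ κx)
                             (cong (replicate (suc c) x′ ++_) (concatMap-groupsL cs t κy κx)))

infix 6 _▸_
_▸_ : Letter → Letter → Profile
p ▸ h = profile p h false false

-- The profile sequence of the reversed Fibonacci word of order 2j + 2 (ABX, XBA) or
-- 2j + 3 (BAX, XAB), sorted in block order o.
Shape : BlockOrder → ℕ → List Profile → Set
Shape ABX j Π = ∃[ p ] ∃[ q ] ∃[ cs ] (length cs ≡ j ×
  Π ≡ profile B A false true ∷ replicate p (B ▸ A)
        ++ groupsR (A ▸ A) (B ▸ A) cs (profile X B true false ∷ replicate q (A ▸ B) ++ A ▸ X ∷ []))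
Shape BAX j Π = ∃[ N ] ∃[ p ] ∃[ q ] ∃[ cs ] (length cs ≡ j ×
  Π ≡ profile A B false true ∷ replicate N (A ▸ B) ++ profile X A true false ∷ replicate p (A ▸ A)
        ++ groupsR (B ▸ A) (A ▸ A) cs (replicate (suc q) (B ▸ A) ++ A ▸ X ∷ []))
Shape XAB j Π = ∃[ n ] ∃[ g ] ∃[ h ] ∃[ cs ] (length cs ≡ j ×
  Π ≡ A ▸ X ∷ replicate (suc n) (B ▸ A)
        ++ groupsL (A ▸ A) (B ▸ A) cs (replicate g (A ▸ A) ++ profile X A true false
                                         ∷ replicate h (A ▸ B) ++ profile A B false true ∷ []))
Shape XBA j Π = ∃[ n ] ∃[ g ] ∃[ cs ] (length cs ≡ j ×
  Π ≡ A ▸ X ∷ replicate n (A ▸ B) ++ profile X B true false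
        ∷ groupsL (B ▸ A) (A ▸ A) cs (replicate g (B ▸ A) ++ profile B A false true ∷ []))

shape-BAX : ∀ {j Π} → Shape ABX j Π → Shape BAX j (φProfiles BAX Π)
shape-BAX (p , q , cs , |cs| , refl) = N , p , q , cs , |cs| , (begin
  concatMap nextB Π ++ concatMap nextA Π ++ A ▸ X ∷ []
    ≡⟨ cong₂ (λ bs as → bs ++ as ++ A ▸ X ∷ []) B-part A-part ⟩
  profile A B false true ∷ replicate N (A ▸ B) ++ profile X A true false ∷ (replicate p (A ▸ A) ++ G) ++ A ▸ X ∷ []
    ≡⟨ cong (λ r → profile A B false true ∷ replicate N (A ▸ B) ++ profile X A true false ∷ r) A-tail ⟩
  profile A B false true ∷ replicate N (A ▸ B) ++ profile X A true false ∷ replicate p (A ▸ A)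
    ++ groupsR (B ▸ A) (A ▸ A) cs (replicate (suc q) (B ▸ A) ++ A ▸ X ∷ []) ∎)
  where
  open ≡-Reasoning
  N = p + groupsSize cs
  Π = profile B A false true ∷ replicate p (B ▸ A)
        ++ groupsR (A ▸ A) (B ▸ A) cs (profile X B true false ∷ replicate q (A ▸ B) ++ A ▸ X ∷ [])
  G = groupsR (B ▸ A) (A ▸ A) cs (replicate q (B ▸ A) ++ B ▸ A ∷ [])
  A-part : concatMap nextA Π ≡ profile X A true false ∷ replicate p (A ▸ A) ++ G
  A-part = cong (profile X A true false ∷_)
    (≡.trans (concatMap-replicate nextA p (B ▸ A) _ refl) (cong (replicate p (A ▸ A) ++_)
    (≡.trans (concatMap-groupsR nextA cs _ refl refl) (cong (groupsR (B ▸ A) (A ▸ A) cs)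
             (concatMap-replicate nextA q (A ▸ B) (A ▸ X ∷ []) refl)))))
  B-part : concatMap nextB Π ≡ profile A B false true ∷ replicate N (A ▸ B)
  B-part = cong (profile A B false true ∷_)
    (≡.trans (concatMap-replicate nextB p (B ▸ A) _ refl) (≡.trans (cong (replicate p (A ▸ B) ++_)
    (≡.trans (concatMap-groupsR nextB cs _ refl refl)
    (≡.trans (cong (groupsR (A ▸ B) (A ▸ B) cs) (concatMap-replicate-[] nextB q (A ▸ B) (A ▸ X ∷ []) refl))
             (groupsR-same (A ▸ B) cs []))))
    (≡.trans (replicate-++-replicate p (groupsSize cs) (A ▸ B) []) (++-identityʳ (replicate N (A ▸ B))))))
  A-tail : (replicate p (A ▸ A) ++ G) ++ A ▸ X ∷ []
           ≡ replicate p (A ▸ A) ++ groupsR (B ▸ A) (A ▸ A) cs (replicate (suc q) (B ▸ A) ++ A ▸ X ∷ [])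
  A-tail = ≡.trans (++-assoc (replicate p (A ▸ A)) G _) (cong (replicate p (A ▸ A) ++_)
    (≡.trans (groupsR-++ (B ▸ A) (A ▸ A) cs _ _) (cong (groupsR (B ▸ A) (A ▸ A) cs)
             (≡.trans (++-assoc (replicate q (B ▸ A)) _ _) (replicate-∷ q (B ▸ A) _)))))

shape-ABX : ∀ {j Π} → Shape BAX j Π → Shape ABX (suc j) (φProfiles ABX Π)
shape-ABX {j} (N , p , q , cs , |cs| , refl) = N + p , M , cs ∷ʳ q , length-∷ʳ-≡ , (begin
  concatMap nextA Π ++ concatMap nextB Π ++ A ▸ X ∷ []
    ≡⟨ cong₂ (λ as bs → as ++ bs ++ A ▸ X ∷ []) A-part B-part ⟩
  profile B A false true ∷ (replicate N (B ▸ A) ++ replicate p (B ▸ A) ++ G) ++ Z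
    ≡⟨ cong (profile B A false true ∷_) (≡.trans (++-assoc (replicate N (B ▸ A)) _ Z)
                                         (cong (replicate N (B ▸ A) ++_) (++-assoc (replicate p (B ▸ A)) G Z))) ⟩
  profile B A false true ∷ replicate N (B ▸ A) ++ replicate p (B ▸ A) ++ G ++ Z
    ≡⟨ cong (profile B A false true ∷_) (replicate-++-replicate N p (B ▸ A) _) ⟩
  profile B A false true ∷ replicate (N + p) (B ▸ A) ++ G ++ Z
    ≡⟨ cong (λ r → profile B A false true ∷ replicate (N + p) (B ▸ A) ++ r) G-tail ⟩
  profile B A false true ∷ replicate (N + p) (B ▸ A) ++ groupsR (A ▸ A) (B ▸ A) (cs ∷ʳ q) Z ∎)
  where
  open ≡-Reasoning
  M = p + (groupsSize cs + suc q)
  Π = profile A B false true ∷ replicate N (A ▸ B) ++ profile X A true false ∷ replicate p (A ▸ A)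
        ++ groupsR (B ▸ A) (A ▸ A) cs (replicate (suc q) (B ▸ A) ++ A ▸ X ∷ [])
  G = groupsR (A ▸ A) (B ▸ A) cs (replicate (suc q) (A ▸ A) ++ B ▸ A ∷ [])
  Z = profile X B true false ∷ replicate M (A ▸ B) ++ A ▸ X ∷ []
  length-∷ʳ-≡ : length (cs ∷ʳ q) ≡ suc j
  length-∷ʳ-≡ = ≡.trans (length-++ cs) (≡.trans (+-comm (length cs) 1) (cong suc |cs|))
  A-part : concatMap nextA Π ≡ profile B A false true ∷ replicate N (B ▸ A) ++ replicate p (B ▸ A) ++ G
  A-part = cong (profile B A false true ∷_)
    (≡.trans (concatMap-replicate nextA N (A ▸ B) _ refl) (cong (replicate N (B ▸ A) ++_)
    (≡.trans (concatMap-replicate nextA p (A ▸ A) _ refl) (cong (replicate p (B ▸ A) ++_)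
    (≡.trans (concatMap-groupsR nextA cs _ refl refl) (cong (groupsR (A ▸ A) (B ▸ A) cs)
             (concatMap-replicate nextA (suc q) (B ▸ A) (A ▸ X ∷ []) refl)))))))
  B-part : concatMap nextB Π ≡ profile X B true false ∷ replicate M (A ▸ B)
  B-part = ≡.trans (concatMap-replicate-[] nextB N (A ▸ B) _ refl) (cong (profile X B true false ∷_)
    (≡.trans (concatMap-replicate nextB p (A ▸ A) _ refl) (≡.trans (cong (replicate p (A ▸ B) ++_)
    (≡.trans (concatMap-groupsR nextB cs _ refl refl)
    (≡.trans (cong (groupsR (A ▸ B) (A ▸ B) cs) (concatMap-replicate nextB (suc q) (B ▸ A) (A ▸ X ∷ []) refl))
    (≡.trans (groupsR-same (A ▸ B) cs _) (replicate-++-replicate (groupsSize cs) (suc q) (A ▸ B) [])))))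
    (≡.trans (replicate-++-replicate p (groupsSize cs + suc q) (A ▸ B) []) (++-identityʳ (replicate M (A ▸ B)))))))
  G-tail : G ++ Z ≡ groupsR (A ▸ A) (B ▸ A) (cs ∷ʳ q) Z
  G-tail = ≡.trans (groupsR-++ (A ▸ A) (B ▸ A) cs _ Z) (≡.trans (cong (groupsR (A ▸ A) (B ▸ A) cs)
             (++-assoc (replicate (suc q) (A ▸ A)) _ Z)) (sym (groupsR-∷ʳ (A ▸ A) (B ▸ A) cs q Z)))

shape-XAB : ∀ {j Π} → Shape XBA j Π → Shape XAB j (φProfiles XAB Π)
shape-XAB (n , g , cs , |cs| , refl) = n , g , H , cs , |cs| , (begin
  A ▸ X ∷ concatMap nextA Π ++ concatMap nextB Π
    ≡⟨ cong₂ (λ as bs → A ▸ X ∷ as ++ bs) A-part B-part ⟩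
  A ▸ X ∷ (replicate (suc n) (B ▸ A) ++ groupsL (A ▸ A) (B ▸ A) cs (replicate g (A ▸ A) ++ profile X A true false ∷ []))
        ++ Y
    ≡⟨ cong (A ▸ X ∷_) (≡.trans (++-assoc (replicate (suc n) (B ▸ A)) _ Y) (cong (replicate (suc n) (B ▸ A) ++_)
         (≡.trans (groupsL-++ (A ▸ A) (B ▸ A) cs _ Y) (cong (groupsL (A ▸ A) (B ▸ A) cs)
                  (++-assoc (replicate g (A ▸ A)) (profile X A true false ∷ []) Y))))) ⟩
  A ▸ X ∷ replicate (suc n) (B ▸ A) ++ groupsL (A ▸ A) (B ▸ A) cs (replicate g (A ▸ A) ++ profile X A true false ∷ Y) ∎)
  where
  open ≡-Reasoning
  H = groupsSize cs + g
  Π = A ▸ X ∷ replicate n (A ▸ B) ++ profile X B true false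
        ∷ groupsL (B ▸ A) (A ▸ A) cs (replicate g (B ▸ A) ++ profile B A false true ∷ [])
  Y = replicate H (A ▸ B) ++ profile A B false true ∷ []
  A-part : concatMap nextA Π ≡ replicate (suc n) (B ▸ A)
                                 ++ groupsL (A ▸ A) (B ▸ A) cs (replicate g (A ▸ A) ++ profile X A true false ∷ [])
  A-part = cong (B ▸ A ∷_)
    (≡.trans (concatMap-replicate nextA n (A ▸ B) _ refl) (cong (replicate n (B ▸ A) ++_)
    (≡.trans (concatMap-groupsL nextA cs _ refl refl) (cong (groupsL (A ▸ A) (B ▸ A) cs)
             (concatMap-replicate nextA g (B ▸ A) (profile B A false true ∷ []) refl)))))
  B-part : concatMap nextB Π ≡ Y
  B-part =
    ≡.trans (concatMap-replicate-[] nextB n (A ▸ B) _ refl)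
    (≡.trans (concatMap-groupsL nextB cs _ refl refl)
    (≡.trans (cong (groupsL (A ▸ B) (A ▸ B) cs) (concatMap-replicate nextB g (B ▸ A) (profile B A false true ∷ []) refl))
    (≡.trans (groupsL-same (A ▸ B) cs _) (replicate-++-replicate (groupsSize cs) g (A ▸ B) _))))

shape-XBA : ∀ {j Π} → Shape XAB j Π → Shape XBA (suc j) (φProfiles XBA Π)
shape-XBA (n , g , h , cs , |cs| , refl) = N , g + h , n ∷ cs , cong suc |cs| , (begin
  A ▸ X ∷ concatMap nextB Π ++ concatMap nextA Π
    ≡⟨ cong₂ (λ bs as → A ▸ X ∷ bs ++ as) B-part A-part ⟩
  A ▸ X ∷ (replicate N (A ▸ B) ++ profile X B true false ∷ []) ++ G
    ≡⟨ cong (A ▸ X ∷_) (++-assoc (replicate N (A ▸ B)) _ G) ⟩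
  A ▸ X ∷ replicate N (A ▸ B) ++ profile X B true false ∷ G ∎)
  where
  open ≡-Reasoning
  N = suc n + (groupsSize cs + g)
  Π = A ▸ X ∷ replicate (suc n) (B ▸ A)
        ++ groupsL (A ▸ A) (B ▸ A) cs (replicate g (A ▸ A) ++ profile X A true false
                                         ∷ replicate h (A ▸ B) ++ profile A B false true ∷ [])
  G = groupsL (B ▸ A) (A ▸ A) (n ∷ cs) (replicate (g + h) (B ▸ A) ++ profile B A false true ∷ [])
  A-part : concatMap nextA Π ≡ G
  A-part = cong (B ▸ A ∷_)
    (≡.trans (concatMap-replicate nextA (suc n) (B ▸ A) _ refl) (cong (replicate (suc n) (A ▸ A) ++_)
    (≡.trans (concatMap-groupsL nextA cs _ refl refl) (cong (groupsL (B ▸ A) (A ▸ A) cs)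
    (≡.trans (concatMap-replicate nextA g (A ▸ A) _ refl) (≡.trans (cong (replicate g (B ▸ A) ++_)
             (concatMap-replicate nextA h (A ▸ B) (profile A B false true ∷ []) refl))
             (replicate-++-replicate g h (B ▸ A) _)))))))
  B-part : concatMap nextB Π ≡ replicate N (A ▸ B) ++ profile X B true false ∷ []
  B-part =
    ≡.trans (concatMap-replicate nextB (suc n) (B ▸ A) _ refl) (≡.trans (cong (replicate (suc n) (A ▸ B) ++_)
    (≡.trans (concatMap-groupsL nextB cs _ refl refl)
    (≡.trans (cong (groupsL (A ▸ B) (A ▸ B) cs)
      (≡.trans (concatMap-replicate nextB g (A ▸ A) _ refl) (cong (λ r → replicate g (A ▸ B) ++ profile X B true false ∷ r)
               (concatMap-replicate-[] nextB h (A ▸ B) (profile A B false true ∷ []) refl))))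
    (≡.trans (groupsL-same (A ▸ B) cs _) (replicate-++-replicate (groupsSize cs) g (A ▸ B) _)))))
    (replicate-++-replicate (suc n) (groupsSize cs + g) (A ▸ B) _))

double-suc : ∀ j t → 2 * suc j + t ≡ 2 * j + (2 + t)
double-suc = solve 2 (λ j t → con 2 :* (con 1 :+ j) :+ t := con 2 :* j :+ (con 2 :+ t)) refl

module _ {n : ℕ} where

  runs-dup : ∀ (c : Fin n) t → runs (c ∷ c ∷ t) ≡ runs (c ∷ t)
  runs-dup c t = cong (λ β → if β then runs (c ∷ t) else suc (runs (c ∷ t))) (=?-refl c)

  runs-new : ∀ {c d : Fin n} t → c ≢ d → runs (c ∷ d ∷ t) ≡ suc (runs (d ∷ t))
  runs-new {c} {d} t c≢d = cong (λ β → if β then runs (d ∷ t) else suc (runs (d ∷ t))) (isYes-false (c Fin.≟ d) c≢d)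

  runs-replicate : ∀ (c : Fin n) m t → runs (c ∷ replicate m c ++ t) ≡ runs (c ∷ t)
  runs-replicate c zero t = refl
  runs-replicate c (suc m) t = ≡.trans (runs-dup c (replicate m c ++ t)) (runs-replicate c m t)

  runs-groupsR : ∀ {a b : Fin n} → a ≢ b → ∀ cs t → runs (b ∷ groupsR a b cs t) ≡ 2 * length cs + runs (b ∷ t)
  runs-groupsR a≢b [] t = refl
  runs-groupsR {a} {b} a≢b (c ∷ cs) t = begin
    runs (b ∷ a ∷ replicate c a ++ b ∷ G)  ≡⟨ runs-new (replicate c a ++ b ∷ G) (a≢b ∘ sym) ⟩
    suc (runs (a ∷ replicate c a ++ b ∷ G)) ≡⟨ cong suc (runs-replicate a c (b ∷ G)) ⟩
    suc (runs (a ∷ b ∷ G))                  ≡⟨ cong suc (runs-new G a≢b) ⟩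
    suc (suc (runs (b ∷ G)))                ≡⟨ cong (suc ∘ suc) (runs-groupsR a≢b cs t) ⟩
    suc (suc (2 * length cs + runs (b ∷ t))) ≡⟨ cong (_+ runs (b ∷ t)) (ℕ.*-suc 2 (length cs)) ⟨
    2 * suc (length cs) + runs (b ∷ t)       ∎
    where
    open ≡-Reasoning
    G = groupsR a b cs t

  runs-groupsL : ∀ {a b : Fin n} → a ≢ b → ∀ cs t → runs (b ∷ groupsL a b cs t) ≡ 2 * length cs + runs (b ∷ t)
  runs-groupsL a≢b [] t = refl
  runs-groupsL {a} {b} a≢b (c ∷ cs) t = begin
    runs (b ∷ a ∷ b ∷ replicate c b ++ G)    ≡⟨ runs-new (b ∷ replicate c b ++ G) (a≢b ∘ sym) ⟩
    suc (runs (a ∷ b ∷ replicate c b ++ G))   ≡⟨ cong suc (runs-new (replicate c b ++ G) a≢b) ⟩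
    suc (suc (runs (b ∷ replicate c b ++ G))) ≡⟨ cong (suc ∘ suc) (runs-replicate b c G) ⟩
    suc (suc (runs (b ∷ G)))                  ≡⟨ cong (suc ∘ suc) (runs-groupsL a≢b cs t) ⟩
    suc (suc (2 * length cs + runs (b ∷ t)))  ≡⟨ cong (_+ runs (b ∷ t)) (ℕ.*-suc 2 (length cs)) ⟨
    2 * suc (length cs) + runs (b ∷ t)        ∎
    where
    open ≡-Reasoning
    G = groupsL a b cs t

module _ {n : ℕ} {a b x : Fin n} (d : Distinct a b x) where
  open Distinct d
  private
    f : Profile → Fin n
    f = embed a b x ∘ Profile.prev
    κ : Profile → List (Fin n)
    κ t = f t ∷ []

    map≡concatMap : ∀ Π → map f Π ≡ concatMap κ Π
    map≡concatMap Π = sym (concatMap-singletons (All.universal (λ _ → refl) Π))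

    runs-x-tail : ∀ h → runs (x ∷ replicate h a ++ a ∷ []) ≡ 2
    runs-x-tail h = begin
      runs (x ∷ replicate h a ++ a ∷ [])   ≡⟨ cong (λ t → runs (x ∷ t)) (replicate-∷ h a []) ⟩
      runs (x ∷ a ∷ replicate h a ++ [])   ≡⟨ runs-new (replicate h a ++ []) (a≢x ∘ sym) ⟩
      suc (runs (a ∷ replicate h a ++ [])) ≡⟨ cong suc (runs-replicate a h []) ⟩
      2                                    ∎
      where open ≡-Reasoning

    runs-b-tail : ∀ g h → let W = replicate g a ++ x ∷ replicate h a ++ a ∷ [] in
                  3 ≤ runs (b ∷ W) × runs (b ∷ W) ≤ 4
    runs-b-tail zero h rewrite runs-new (replicate h a ++ a ∷ []) b≢x | runs-x-tail h = ℕ.≤-refl , ℕ.n≤1+n 3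
    runs-b-tail (suc g) h rewrite runs-new (replicate g a ++ x ∷ replicate h a ++ a ∷ []) (a≢b ∘ sym)
                                | runs-replicate a g (x ∷ replicate h a ++ a ∷ [])
                                | runs-new (replicate h a ++ a ∷ []) a≢x
                                | runs-x-tail h = ℕ.n≤1+n 3 , ℕ.≤-refl

  -- The preceding letters of Shape ABX and Shape XAB sequences read b⁺ (a⁺ b)ʲ x a⁺ and
  -- a b⁺ (a b⁺)ʲ a* x a⁺ respectively.
  runs-ABX : ∀ {j Π} → Shape ABX j Π → runs (map f Π) ≡ 2 * j + 3
  runs-ABX (p , q , cs , refl , refl) = begin
    runs (map f Π)
      ≡⟨ cong runs (map≡concatMap Π) ⟩
    runs (b ∷ concatMap κ (replicate p (B ▸ A) ++ G))
      ≡⟨ cong (λ t → runs (b ∷ t)) letters ⟩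
    runs (b ∷ replicate p b ++ groupsR a b cs W)
      ≡⟨ runs-replicate b p (groupsR a b cs W) ⟩
    runs (b ∷ groupsR a b cs W)
      ≡⟨ runs-groupsR a≢b cs W ⟩
    2 * length cs + runs (b ∷ W)
      ≡⟨ cong (λ ρ → 2 * length cs + ρ) (runs-new (replicate q a ++ a ∷ []) b≢x) ⟩
    2 * length cs + suc (runs W)
      ≡⟨ cong (λ ρ → 2 * length cs + suc ρ) (runs-x-tail q) ⟩
    2 * length cs + 3 ∎
    where
    open ≡-Reasoning
    G = groupsR (A ▸ A) (B ▸ A) cs (profile X B true false ∷ replicate q (A ▸ B) ++ A ▸ X ∷ [])
    Π = profile B A false true ∷ replicate p (B ▸ A) ++ G
    W = x ∷ replicate q a ++ a ∷ []
    letters : concatMap κ (replicate p (B ▸ A) ++ G) ≡ replicate p b ++ groupsR a b cs W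
    letters = ≡.trans (concatMap-replicate κ p (B ▸ A) G refl) (cong (replicate p b ++_)
              (≡.trans (concatMap-groupsR κ cs _ refl refl)
                       (cong (λ t → groupsR a b cs (x ∷ t)) (concatMap-replicate κ q (A ▸ B) (A ▸ X ∷ []) refl))))

  runs-XAB : ∀ {j Π} → Shape XAB j Π → 2 * j + 4 ≤ runs (map f Π) × runs (map f Π) ≤ 2 * j + 5
  runs-XAB (m , g , h , cs , refl , refl) =
    (begin
      2 * length cs + 4                  ≡⟨ +-suc (2 * length cs) 3 ⟩
      suc (2 * length cs + 3)            ≤⟨ s≤s (+-monoʳ-≤ (2 * length cs) (proj₁ (runs-b-tail g h))) ⟩
      suc (2 * length cs + runs (b ∷ W)) ≡⟨ runs-Π ⟨
      runs (map f Π)                     ∎)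
    , (begin
      runs (map f Π)                     ≡⟨ runs-Π ⟩
      suc (2 * length cs + runs (b ∷ W)) ≤⟨ s≤s (+-monoʳ-≤ (2 * length cs) (proj₂ (runs-b-tail g h))) ⟩
      suc (2 * length cs + 4)            ≡⟨ +-suc (2 * length cs) 4 ⟨
      2 * length cs + 5                  ∎)
    where
    open ℕ.≤-Reasoning
    W = replicate g a ++ x ∷ replicate h a ++ a ∷ []
    G = groupsL (A ▸ A) (B ▸ A) cs (replicate g (A ▸ A) ++ profile X A true false
                                      ∷ replicate h (A ▸ B) ++ profile A B false true ∷ [])
    Π = A ▸ X ∷ replicate (suc m) (B ▸ A) ++ G
    letters : concatMap κ (replicate (suc m) (B ▸ A) ++ G) ≡ b ∷ replicate m b ++ groupsL a b cs W
    letters = ≡.trans (concatMap-replicate κ (suc m) (B ▸ A) G refl) (cong (λ t → b ∷ replicate m b ++ t)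
              (≡.trans (concatMap-groupsL κ cs _ refl refl) (cong (groupsL a b cs)
              (≡.trans (concatMap-replicate κ g (A ▸ A) _ refl) (cong (λ t → replicate g a ++ x ∷ t)
                       (concatMap-replicate κ h (A ▸ B) (profile A B false true ∷ []) refl))))))
    runs-Π : runs (map f Π) ≡ suc (2 * length cs + runs (b ∷ W))
    runs-Π = begin-equality
      runs (map f Π)                                  ≡⟨ cong runs (map≡concatMap Π) ⟩
      runs (a ∷ concatMap κ (replicate (suc m) (B ▸ A) ++ G)) ≡⟨ cong (λ t → runs (a ∷ t)) letters ⟩
      runs (a ∷ b ∷ replicate m b ++ groupsL a b cs W) ≡⟨ runs-new (replicate m b ++ groupsL a b cs W) a≢b ⟩
      suc (runs (b ∷ replicate m b ++ groupsL a b cs W)) ≡⟨ cong suc (runs-replicate b m (groupsL a b cs W)) ⟩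
      suc (runs (b ∷ groupsL a b cs W))               ≡⟨ cong suc (runs-groupsL a≢b cs W) ⟩
      suc (2 * length cs + runs (b ∷ W))              ∎

-- Reversed Fibonacci words

rev-++ : ∀ {T : Set} (u v : List T) → rev (u ++ v) ≡ rev v ++ rev u
rev-++ [] v = sym (++-identityʳ (rev v))
rev-++ (c ∷ u) v = ≡.trans (cong (_++ c ∷ []) (rev-++ u v)) (++-assoc (rev v) (rev u) (c ∷ []))

revFib : ℕ → List Letter
revFib zero = B ∷ []
revFib (suc m) = φ (revFib m)

revFib-++ : ∀ m → revFib (2 + m) ≡ revFib m ++ revFib (1 + m)
revFib-++ zero = refl
revFib-++ (suc m) = ≡.trans (cong φ (revFib-++ m)) (φ-++ (revFib m) (revFib (suc m)))

rev-fib : ∀ {n} (a b x : Fin n) m → rev (fib a b m) ≡ map (embed a b x) (revFib m)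
rev-fib a b x zero = refl
rev-fib a b x (suc zero) = refl
rev-fib a b x (suc (suc m)) = begin
  rev (fib a b (suc m) ++ fib a b m)
    ≡⟨ rev-++ (fib a b (suc m)) (fib a b m) ⟩
  rev (fib a b m) ++ rev (fib a b (suc m))
    ≡⟨ cong₂ _++_ (rev-fib a b x m) (rev-fib a b x (suc m)) ⟩
  map (embed a b x) (revFib m) ++ map (embed a b x) (revFib (suc m))
    ≡⟨ map-++ (embed a b x) (revFib m) (revFib (suc m)) ⟨
  map (embed a b x) (revFib m ++ revFib (suc m))
    ≡⟨ cong (map (embed a b x)) (revFib-++ m) ⟨
  map (embed a b x) (revFib (suc (suc m))) ∎
  where open ≡-Reasoning

revFib-admissible : ∀ j → Admissible (revFib (2 + j))
revFib-admissible zero = admissible (isB ∷ isA ∷ []) λ { (_ , ()) }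
revFib-admissible (suc j) = φ-admissible (revFib-admissible j)

revFib-AB : ∀ m → All IsAB (revFib m)
revFib-AB zero = isB ∷ []
revFib-AB (suc m) = φ-AB (revFib-AB m)

module _ {n : ℕ} {e : Letter → Fin n} (e-inj : Injective _≡_ _≡_ e) where

  profiles-BA : ∀ {o} → BlocksOrdered e o →
                profiles e (B ∷ A ∷ []) ≡ arrange o (profile B A false true ∷ []) (profile X B true false ∷ []) (A ▸ X ∷ [])
  profiles-BA {o} ordered = begin
    map (profileIn w) (sortOn e (suffixes w))
      ≡⟨ cong (map (profileIn w)) (S.sort-↭ (↭-trans (↭-swap _ _ ↭-refl) (arrange-↭ o ax bax xx))) ⟩
    map (profileIn w) (sortOn e (arrange o ax bax xx))
      ≡⟨ cong (map (profileIn w)) (S.sort-arrange o ordered ((_ , refl) ∷ []) ((_ , refl) ∷ []) ((_ , refl) ∷ [])) ⟩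
    map (profileIn w) (arrange o ax bax xx)
      ≡⟨ map-arrange (profileIn w) o ax bax xx ⟩
    arrange o (profile B A false true ∷ []) (profile X B true false ∷ []) (A ▸ X ∷ []) ∎
    where
    open ≡-Reasoning
    module S = SuffixSort e-inj
    w = B ∷ A ∷ X ∷ []
    ax = (A ∷ X ∷ []) ∷ []
    bax = w ∷ []
    xx = (X ∷ []) ∷ []

r-rev-fib : ∀ {n} {a b x : Fin n} → Distinct a b x → ∀ m →
            r (rev (fib a b m) ++ x ∷ []) ≡ runs (map (embed a b x ∘ Profile.prev) (profiles (embed a b x) (revFib m)))
r-rev-fib {a = a} {b} {x} d m = ≡.trans (cong (runs ∘ BWT) word) (cong runs (BWT-profiles d (revFib-AB m)))
  where
  word : rev (fib a b m) ++ x ∷ [] ≡ map (embed a b x) (revFib m ∷ʳ X)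
  word = ≡.trans (cong (_++ x ∷ []) (rev-fib a b x m)) (sym (map-++ (embed a b x) (revFib m) (X ∷ [])))

module _ {n : ℕ} {a b x : Fin n} (a<b : a <ᶠ b) (b<x : b <ᶠ x) where
  private
    d : Distinct a b x
    d = record { a≢b = Finₚ.<⇒≢ a<b ; a≢x = Finₚ.<⇒≢ (Finₚ.<-trans a<b b<x) ; b≢x = Finₚ.<⇒≢ b<x }

  shapes-ABX : ∀ j → Shape ABX j (profiles (embed a b x) (revFib (2 + 2 * j)))
  shapes-BAX : ∀ j → Shape BAX j (profiles (embed b a x) (revFib (3 + 2 * j)))

  shapes-ABX zero = ≡.subst (Shape ABX 0) (sym (profiles-BA (embed-injective d) {ABX} (a<b , b<x)))
                      (0 , 0 , [] , refl , refl)
  shapes-ABX (suc j) =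
    ≡.subst (λ m → Shape ABX (suc j) (profiles (embed a b x) (revFib (2 + m)))) (sym (ℕ.*-suc 2 j))
      (≡.subst (Shape ABX (suc j)) (sym (profiles-φ d {ABX} (a<b , b<x) (revFib-admissible (1 + 2 * j))))
        (shape-ABX (shapes-BAX j)))
  shapes-BAX j =
    ≡.subst (Shape BAX j) (sym (profiles-φ (swapDistinct d) {BAX} (a<b , b<x) (revFib-admissible (2 * j))))
      (shape-BAX (shapes-ABX j))

  r-even : ∀ j → r (rev (fib a b (2 * suc j)) ++ x ∷ []) ≡ 2 * suc j + 1
  r-even j = begin
    r (rev (fib a b (2 * suc j)) ++ x ∷ [])  ≡⟨ cong (λ m → r (rev (fib a b m) ++ x ∷ [])) (ℕ.*-suc 2 j) ⟩
    r (rev (fib a b (2 + 2 * j)) ++ x ∷ [])  ≡⟨ r-rev-fib d (2 + 2 * j) ⟩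
    runs (map (embed a b x ∘ Profile.prev) (profiles (embed a b x) (revFib (2 + 2 * j))))
                                             ≡⟨ runs-ABX d (shapes-ABX j) ⟩
    2 * j + 3                                ≡⟨ double-suc j 1 ⟨
    2 * suc j + 1                            ∎
    where open ≡-Reasoning

module _ {n : ℕ} {a b x : Fin n} (x<a : x <ᶠ a) (a<b : a <ᶠ b) where
  private
    d : Distinct a b x
    d = record
      { a≢b = Finₚ.<⇒≢ a<b ; a≢x = Finₚ.<⇒≢ x<a ∘ sym ; b≢x = Finₚ.<⇒≢ (Finₚ.<-trans x<a a<b) ∘ sym }

  shapes-XBA : ∀ j → Shape XBA j (profiles (embed b a x) (revFib (2 + 2 * j)))
  shapes-XAB : ∀ j → Shape XAB j (profiles (embed a b x) (revFib (3 + 2 * j)))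

  shapes-XBA zero = ≡.subst (Shape XBA 0) (sym (profiles-BA (embed-injective (swapDistinct d)) {XBA} (x<a , a<b)))
                      (0 , 0 , [] , refl , refl)
  shapes-XBA (suc j) =
    ≡.subst (λ m → Shape XBA (suc j) (profiles (embed b a x) (revFib (2 + m)))) (sym (ℕ.*-suc 2 j))
      (≡.subst (Shape XBA (suc j))
               (sym (profiles-φ (swapDistinct d) {XBA} (x<a , a<b) (revFib-admissible (1 + 2 * j))))
        (shape-XBA (shapes-XAB j)))
  shapes-XAB j = ≡.subst (Shape XAB j) (sym (profiles-φ d {XAB} (x<a , a<b) (revFib-admissible (2 * j))))
                   (shape-XAB (shapes-XBA j))

  r-odd : ∀ j → 2 * suc j + 2 ≤ r (rev (fib a b (2 * suc j + 1)) ++ x ∷ [])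
              × r (rev (fib a b (2 * suc j + 1)) ++ x ∷ []) ≤ 2 * suc j + 3
  r-odd j rewrite double-suc j 2 | double-suc j 3 =
    ≡.subst (λ ρ → 2 * j + 4 ≤ ρ × ρ ≤ 2 * j + 5) (sym r≡runs) (runs-XAB d (shapes-XAB j))
    where
    r≡runs : r (rev (fib a b (2 * suc j + 1)) ++ x ∷ [])
             ≡ runs (map (embed a b x ∘ Profile.prev) (profiles (embed a b x) (revFib (3 + 2 * j))))
    r≡runs = ≡.trans (cong (λ m → r (rev (fib a b m) ++ x ∷ [])) (≡.trans (double-suc j 1) (+-comm (2 * j) 3)))
                     (r-rev-fib d (3 + 2 * j))

proposition2 : (n : ℕ) (a b : Fin n) → a <ᶠ b →
    ((k : ℕ) → 2 ≤ length (rev (fib a b (2 * k))) → (x : Fin n) → b <ᶠ x →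
       r (rev (fib a b (2 * k)) ++ (x ∷ [])) ≡ 2 * k + 1)
    ×
    ((k : ℕ) → 2 ≤ length (rev (fib a b (2 * k + 1))) → (x : Fin n) → x <ᶠ a →
       (2 * k + 2 ≤ r (rev (fib a b (2 * k + 1)) ++ (x ∷ [])))
       × (r (rev (fib a b (2 * k + 1)) ++ (x ∷ [])) ≤ 2 * k + 3))
proposition2 n a b a<b =
    (λ { zero (s≤s ()) ; (suc j) _ x b<x → r-even a<b b<x j })
  , (λ { zero (s≤s ()) ; (suc j) _ x x<a → r-odd x<a a<b j })
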